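{- Let $k\ge1$ and let $A$ be a real matrix with at least $2k$ rows and at least $2k$ columns. Let $R_S=C_S=\{1,\dots,k\}$ and $R_T=C_T=\{k+1,\dots,2k\}$. Define \[ s_1=\sum_{i\in R_S,\,i'\in R_T,\,j\in C_S,\,j'\in C_T}\delta^{\{i,i'\},\{j,j'\}}\,[R_S\Delta\{i,i'\},C_S\Delta\{j,j'\}]\cdot[R_T\Delta\{i,i'\},C_T\Delta\{j,j'\}], \] \[ s_2=(-1)^k\sum_{i\in R_S,\,i'\in R_T}\delta^{\{i,i'\},\emptyset}\,[R_S\Delta\{i,i'\},C_S]\cdot[R_T\Delta\{i,i'\},C_T], \] \[ s_3=\sum_{\substack{i,h\in R_S,\ i<h\\ i',h'\in R_T,\ i'<h'}}\delta^{\{i,i',h,h'\},\emptyset}\,[R_S\Delta\{i,h,i',h'\},C_S]\cdot[R_T\Delta\{i,h,i',h'\},C_T]. \] Then \[ s_1-2(k-1)s_2-4s_3-k^2\,[R_S,C_S]\,[R_T,C_T]=0. \]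
   Context: For a set $R$ of row indices and a set $C$ of column indices with $\lvert R\rvert=\lvert C\rvert$, $[R,C]$ denotes $\det(A_{R,C})$, the determinant of the submatrix of $A$ with rows $R$ and columns $C$, each taken in increasing order. $\Delta$ is symmetric difference. For a finite set $L$ of integers and $i\in L$, $r_L(i)$ is the number of elements of $L$ smaller than $i$. For $U_R\subseteq R_S\Delta R_T$ and $U_C\subseteq C_S\Delta C_T$, the sign is $\delta^{U_R,U_C}=(-1)^{\sum_{i\in U_R}r_*(i)+\sum_{j\in U_C}r_*(j)}$, where for a row index $r_*(i)=r_{R_S}(i)$ if $i\in R_S$ and $r_*(i)=r_{R_T}(i)$ if $i\in R_T$, and for a column index $r_*(j)=r_{C_S}(j)$ if $j\in C_S$ and $r_*(j)=r_{C_T}(j)$ if $j\in C_T$. -}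

module Defs where

open import Level using (Level)
open import Data.Bool using (Bool; true; false; if_then_else_; _∧_; _∨_; _xor_)
open import Data.Nat using () renaming (_+_ to _+ℕ_)
open import Data.Nat using (ℕ; zero; suc; _<ᵇ_; _≡ᵇ_; _≤ᵇ_)
open import Data.Fin using (Fin; toℕ)
open import Data.List using (List; []; _∷_; length; lookup; removeAt; allFin; filterᵇ; foldr; map)
open import Algebra.Bundles using (CommutativeRing)

-- A subset of the index set {0,…,m-1} (0-based indices), as a Boolean predicate.
Sub : ℕ → Set
Sub m = Fin m → Bool

elems : ∀ {m} → Sub m → List (Fin m)
elems {m} S = filterᵇ S (allFin m)

_Δ_ : ∀ {m} → Sub m → Sub m → Sub m
(S Δ T) i = S i xor T i

pair : ∀ {m} → Fin m → Fin m → Sub m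
pair a b i = (toℕ i ≡ᵇ toℕ a) ∨ (toℕ i ≡ᵇ toℕ b)

quad : ∀ {m} → Fin m → Fin m → Fin m → Fin m → Sub m
quad a b c d i = pair a b i ∨ pair c d i

∅ : ∀ {m} → Sub m
∅ _ = false

interval : ∀ {m} → ℕ → ℕ → Sub m
interval a b i = (a ≤ᵇ toℕ i) ∧ (toℕ i <ᵇ b)

rank : ∀ {m} → Sub m → Fin m → ℕ
rank L i = length (filterᵇ (λ j → toℕ j <ᵇ toℕ i) (elems L))

rstar : ∀ {m} → Sub m → Sub m → Fin m → ℕ
rstar S T i = if S i then rank S i else rank T i

sumℕ : ∀ {m} → Sub m → (Fin m → ℕ) → ℕ
sumℕ U f = foldr (λ i acc → f i +ℕ acc) 0 (elems U)

δexp : ∀ {m n} → (RS RT : Sub m) (CS CT : Sub n) (UR : Sub m) (UC : Sub n) → ℕ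
δexp RS RT CS CT UR UC = sumℕ UR (rstar RS RT) +ℕ sumℕ UC (rstar CS CT)

module _ {c ℓ : Level} (R : CommutativeRing c ℓ) where
  open CommutativeRing R

  sgn : ℕ → Carrier
  sgn zero = 1#
  sgn (suc e) = - sgn e

  nat : ℕ → Carrier
  nat zero = 0#
  nat (suc n) = 1# + nat n

  δ : ∀ {m n} → (RS RT : Sub m) (CS CT : Sub n) (UR : Sub m) (UC : Sub n) → Carrier
  δ RS RT CS CT UR UC = sgn (δexp RS RT CS CT UR UC)

  sumL : ∀ {a} {X : Set a} → List X → (X → Carrier) → Carrier
  sumL xs f = foldr (λ x acc → f x + acc) 0# xs

  ΣS : ∀ {m} → Sub m → (Fin m → Carrier) → Carrier
  ΣS S f = sumL (elems S) f

  detL : ∀ {m n} → (Fin m → Fin n → Carrier) → List (Fin m) → List (Fin n) → Carrier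
  detL A [] [] = 1#
  detL A [] (_ ∷ _) = 0#
  detL A (r ∷ rs) cs =
    sumL (allFin (length cs)) (λ j → sgn (toℕ j) * (A r (lookup cs j) * detL A rs (removeAt cs j)))

  -- [R,C] = det(A_{R,C}), rows and columns in increasing order
  minor : ∀ {m n} → (Fin m → Fin n → Carrier) → Sub m → Sub n → Carrier
  minor A Rw Cl = detL A (elems Rw) (elems Cl)

module Submission where

-- Write S and T for the two diagonal k × k blocks.  After sorting rows and columns, a summand of s₁ is
-- det S · det T with one row and one column exchanged between the blocks, and δ cancels the sorting signs
-- (likewise for s₂ and s₃, where only rows are exchanged).  For a fixed row exchange, the sum over all column
-- exchanges equals the sum over all further row exchanges, by Laplace expansion along the exchanged lines.
-- A further row exchange either undoes the first one (giving k² copies of [R_S,C_S][R_T,C_T]), shares exactly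
-- one index with it (a row transposition inside a block, giving 2(k-1) copies of each term of s₂), or yields a
-- double exchange (each term of s₃ arising four times).

open import Defs
open import Level using (Level)
open import Function using (_∘_)
open import Data.Bool using (Bool; true; false; if_then_else_; _∧_; _∨_; _xor_; T?)
open import Data.Nat using (ℕ; zero; suc; pred; _≤_; _<_; _∸_; _<ᵇ_; _≡ᵇ_; _≤ᵇ_; z≤n; s≤s; _≟_; _<?_)
  renaming (_+_ to _+ℕ_; _*_ to _*ℕ_)
import Data.Nat.Properties as ℕₚ
open import Data.Nat.Tactic.RingSolver using (solve-∀)
open import Data.Fin using (Fin; toℕ; fromℕ<) renaming (zero to fzero; suc to fsuc)
import Data.Fin.Properties as Finₚ
open import Data.List using (List; []; _∷_; _++_; length; map; foldr; filterᵇ; applyUpTo; upTo; allFin; tabulate; removeAt; lookup)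
import Data.List.Properties as Listₚ
open import Data.Empty using (⊥-elim)
open import Relation.Nullary using (yes; no)
open import Relation.Binary.Definitions using (tri<; tri≈; tri>)
import Relation.Binary.PropositionalEquality as ≡
open ≡ using (_≡_; _≢_)
open import Algebra.Bundles using (CommutativeRing)

-- Indices are natural numbers; `punchIn j` enumerates ℕ ∖ {j} in increasing order.

punchIn : ℕ → ℕ → ℕ
punchIn zero    b       = suc b
punchIn (suc j) zero    = zero
punchIn (suc j) (suc b) = suc (punchIn j b)

punchOut : ℕ → ℕ → ℕ
punchOut zero    zero    = zero
punchOut zero    (suc y) = y
punchOut (suc x) zero    = zero
punchOut (suc x) (suc y) = suc (punchOut x y)

punchInⱼ≢j : ∀ j b → punchIn j b ≢ j
punchInⱼ≢j zero    b       ()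
punchInⱼ≢j (suc j) zero    ()
punchInⱼ≢j (suc j) (suc b) e = punchInⱼ≢j j b (ℕₚ.suc-injective e)

punchIn-< : ∀ {j b} → b < j → punchIn j b ≡ b
punchIn-< {suc j} {zero}  _         = ≡.refl
punchIn-< {suc j} {suc b} (s≤s b<j) = ≡.cong suc (punchIn-< b<j)

punchIn-≥ : ∀ {j b} → j ≤ b → punchIn j b ≡ suc b
punchIn-≥ {zero}  {b}     _         = ≡.refl
punchIn-≥ {suc j} {suc b} (s≤s j≤b) = ≡.cong suc (punchIn-≥ j≤b)

punchIn-≤ : ∀ j b → punchIn j b ≤ suc b
punchIn-≤ zero    b       = ℕₚ.≤-refl
punchIn-≤ (suc j) zero    = z≤n
punchIn-≤ (suc j) (suc b) = s≤s (punchIn-≤ j b)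

punchIn-<-suc : ∀ {p} j {b} → b < p → punchIn j b < suc p
punchIn-<-suc j {b} b<p = ℕₚ.≤-trans (s≤s (punchIn-≤ j b)) (s≤s b<p)

punchOut-punchIn : ∀ j b → punchOut j (punchIn j b) ≡ b
punchOut-punchIn zero    b       = ≡.refl
punchOut-punchIn (suc j) zero    = ≡.refl
punchOut-punchIn (suc j) (suc b) = ≡.cong suc (punchOut-punchIn j b)

punchIn-punchOut : ∀ {x y} → y ≢ x → punchIn x (punchOut x y) ≡ y
punchIn-punchOut {zero}  {zero}  y≢x = ⊥-elim (y≢x ≡.refl)
punchIn-punchOut {zero}  {suc y} _   = ≡.refl
punchIn-punchOut {suc x} {zero}  _   = ≡.refl
punchIn-punchOut {suc x} {suc y} y≢x = ≡.cong suc (punchIn-punchOut (y≢x ∘ ≡.cong suc))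

punchIn-punchIn : ∀ c d b → punchIn (punchIn c d) (punchIn (punchOut (punchIn c d) c) b) ≡ punchIn c (punchIn d b)
punchIn-punchIn zero    d       b       = ≡.refl
punchIn-punchIn (suc c) zero    b       = ≡.refl
punchIn-punchIn (suc c) (suc d) zero    = ≡.refl
punchIn-punchIn (suc c) (suc d) (suc b) = ≡.cong suc (punchIn-punchIn c d b)

punchIn≡-below : ∀ {a b y} → a < b → punchIn b y ≡ a → y ≡ a
punchIn≡-below {a} {b} {y} a<b e with y ℕₚ.<? b
... | yes y<b = ≡.trans (≡.sym (punchIn-< y<b)) e
... | no  y≮b = ⊥-elim (ℕₚ.<-irrefl (≡.trans (≡.sym e) (punchIn-≥ b≤y)) (ℕₚ.<-≤-trans a<b (ℕₚ.≤-trans b≤y (ℕₚ.n≤1+n y))))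
  where b≤y = ℕₚ.≮⇒≥ y≮b

<ᵇ-true : ∀ {a b} → a < b → (a <ᵇ b) ≡ true
<ᵇ-true {zero}  {suc b} _          = ≡.refl
<ᵇ-true {suc a} {suc b} (s≤s a<b) = <ᵇ-true {a} {b} a<b

<ᵇ-false : ∀ {a b} → b ≤ a → (a <ᵇ b) ≡ false
<ᵇ-false {a}     {zero}  _         = ≡.refl
<ᵇ-false {suc a} {suc b} (s≤s b≤a) = <ᵇ-false {a} {b} b≤a

<ᵇ-true⇒< : ∀ a b → (a <ᵇ b) ≡ true → a < b
<ᵇ-true⇒< zero    (suc b) _ = s≤s z≤n
<ᵇ-true⇒< (suc a) (suc b) e = s≤s (<ᵇ-true⇒< a b e)

<ᵇ-+ˡ : ∀ k x y → (k +ℕ x <ᵇ k +ℕ y) ≡ (x <ᵇ y)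
<ᵇ-+ˡ zero    x y = ≡.refl
<ᵇ-+ˡ (suc k) x y = <ᵇ-+ˡ k x y

≤ᵇ-true : ∀ {a b} → a ≤ b → (a ≤ᵇ b) ≡ true
≤ᵇ-true {zero}          _         = ≡.refl
≤ᵇ-true {suc a} {suc b} (s≤s a≤b) = <ᵇ-true {a} {suc b} (s≤s a≤b)

≤ᵇ-false : ∀ {a b} → b < a → (a ≤ᵇ b) ≡ false
≤ᵇ-false {suc a} {b} (s≤s b≤a) = <ᵇ-false {a} {b} b≤a

≡ᵇ-refl : ∀ a → (a ≡ᵇ a) ≡ true
≡ᵇ-refl zero    = ≡.refl
≡ᵇ-refl (suc a) = ≡ᵇ-refl a

≡ᵇ-false : ∀ {a b} → a ≢ b → (a ≡ᵇ b) ≡ false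
≡ᵇ-false {zero}  {zero}  a≢b = ⊥-elim (a≢b ≡.refl)
≡ᵇ-false {zero}  {suc b} _   = ≡.refl
≡ᵇ-false {suc a} {zero}  _   = ≡.refl
≡ᵇ-false {suc a} {suc b} a≢b = ≡ᵇ-false (a≢b ∘ ≡.cong suc)

≡ᵇ-true⇒≡ : ∀ a b → (a ≡ᵇ b) ≡ true → a ≡ b
≡ᵇ-true⇒≡ zero    zero    _ = ≡.refl
≡ᵇ-true⇒≡ (suc a) (suc b) e = ≡.cong suc (≡ᵇ-true⇒≡ a b e)

≡ᵇ-+ˡ : ∀ k x y → (k +ℕ x ≡ᵇ k +ℕ y) ≡ (x ≡ᵇ y)
≡ᵇ-+ˡ zero    x y = ≡.refl
≡ᵇ-+ˡ (suc k) x y = ≡ᵇ-+ˡ k x y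

module _ {A : Set} (p : A → Bool) where

  filterᵇ-accept : ∀ {x} xs → p x ≡ true → filterᵇ p (x ∷ xs) ≡ x ∷ filterᵇ p xs
  filterᵇ-accept xs px rewrite px = ≡.refl

  filterᵇ-reject : ∀ {x} xs → p x ≡ false → filterᵇ p (x ∷ xs) ≡ filterᵇ p xs
  filterᵇ-reject xs px rewrite px = ≡.refl

  filterᵇ-++ : ∀ xs ys → filterᵇ p (xs ++ ys) ≡ filterᵇ p xs ++ filterᵇ p ys
  filterᵇ-++ = Listₚ.filter-++ (T? ∘ p)

applyUpTo-+ : ∀ {A : Set} (g : ℕ → A) p q → applyUpTo g (p +ℕ q) ≡ applyUpTo g p ++ applyUpTo (λ x → g (p +ℕ x)) q
applyUpTo-+ g zero    q = ≡.refl
applyUpTo-+ g (suc p) q = ≡.cong (g 0 ∷_) (applyUpTo-+ (g ∘ suc) p q)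

module _ (Q : ℕ → Bool) where

  filterᵇ-applyUpTo-all : ∀ (g : ℕ → ℕ) p → (∀ x → x < p → Q (g x) ≡ true) → filterᵇ Q (applyUpTo g p) ≡ applyUpTo g p
  filterᵇ-applyUpTo-all g zero    _ = ≡.refl
  filterᵇ-applyUpTo-all g (suc p) h = ≡.trans (filterᵇ-accept Q _ (h 0 (s≤s z≤n)))
    (≡.cong (g 0 ∷_) (filterᵇ-applyUpTo-all (g ∘ suc) p (λ x x<p → h (suc x) (s≤s x<p))))

  filterᵇ-applyUpTo-none : ∀ (g : ℕ → ℕ) p → (∀ x → x < p → Q (g x) ≡ false) → filterᵇ Q (applyUpTo g p) ≡ []
  filterᵇ-applyUpTo-none g zero    _ = ≡.refl
  filterᵇ-applyUpTo-none g (suc p) h = ≡.trans (filterᵇ-reject Q _ (h 0 (s≤s z≤n)))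
    (filterᵇ-applyUpTo-none (g ∘ suc) p (λ x x<p → h (suc x) (s≤s x<p)))

  filterᵇ-applyUpTo-skip : ∀ (g : ℕ → ℕ) p e → e ≤ p → Q (g e) ≡ false →
    filterᵇ Q (applyUpTo g (suc p)) ≡ filterᵇ Q (applyUpTo (g ∘ punchIn e) p)
  filterᵇ-applyUpTo-skip g p       zero    _         h = filterᵇ-reject Q _ h
  filterᵇ-applyUpTo-skip g (suc p) (suc e) (s≤s e≤p) h with Q (g 0)
  ... | true  = ≡.cong (g 0 ∷_) (filterᵇ-applyUpTo-skip (g ∘ suc) p e e≤p h)
  ... | false = filterᵇ-applyUpTo-skip (g ∘ suc) p e e≤p h

  filterᵇ-applyUpTo-single : ∀ (g : ℕ → ℕ) p e → e < p → Q (g e) ≡ true →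
    (∀ x → x < p → x ≢ e → Q (g x) ≡ false) → filterᵇ Q (applyUpTo g p) ≡ g e ∷ []
  filterᵇ-applyUpTo-single g (suc p) zero _ he hn = ≡.trans (filterᵇ-accept Q _ he)
    (≡.cong (g 0 ∷_) (filterᵇ-applyUpTo-none (g ∘ suc) p (λ x x<p → hn (suc x) (s≤s x<p) (λ ()))))
  filterᵇ-applyUpTo-single g (suc p) (suc e) (s≤s e<p) he hn = ≡.trans (filterᵇ-reject Q _ (hn 0 (s≤s z≤n) (λ ())))
    (filterᵇ-applyUpTo-single (g ∘ suc) p e e<p he (λ x x<p x≢e → hn (suc x) (s≤s x<p) (x≢e ∘ ℕₚ.suc-injective)))

  filterᵇ-applyUpTo-pair : ∀ (g : ℕ → ℕ) p e₁ e₂ → e₁ < e₂ → e₂ < p → Q (g e₁) ≡ true → Q (g e₂) ≡ true →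
    (∀ x → x < p → x ≢ e₁ → x ≢ e₂ → Q (g x) ≡ false) → filterᵇ Q (applyUpTo g p) ≡ g e₁ ∷ g e₂ ∷ []
  filterᵇ-applyUpTo-pair g (suc p) zero (suc e₂) _ (s≤s e₂<p) h₁ h₂ hn = ≡.trans (filterᵇ-accept Q _ h₁)
    (≡.cong (g 0 ∷_) (filterᵇ-applyUpTo-single (g ∘ suc) p e₂ e₂<p h₂
      (λ x x<p x≢e₂ → hn (suc x) (s≤s x<p) (λ ()) (x≢e₂ ∘ ℕₚ.suc-injective))))
  filterᵇ-applyUpTo-pair g (suc p) (suc e₁) (suc e₂) (s≤s e₁<e₂) (s≤s e₂<p) h₁ h₂ hn =
    ≡.trans (filterᵇ-reject Q _ (hn 0 (s≤s z≤n) (λ ()) (λ ())))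
      (filterᵇ-applyUpTo-pair (g ∘ suc) p e₁ e₂ e₁<e₂ e₂<p h₁ h₂
        (λ x x<p x≢e₁ x≢e₂ → hn (suc x) (s≤s x<p) (x≢e₁ ∘ ℕₚ.suc-injective) (x≢e₂ ∘ ℕₚ.suc-injective)))


length-filterᵇ-<ᵇ-applyUpTo : ∀ s e l → e ≤ l → length (filterᵇ (_<ᵇ s +ℕ e) (applyUpTo (s +ℕ_) l)) ≡ e
length-filterᵇ-<ᵇ-applyUpTo s e l e≤l = begin
  length (filterᵇ Q (applyUpTo (s +ℕ_) l))
    ≡⟨ ≡.cong (λ z → length (filterᵇ Q (applyUpTo (s +ℕ_) z))) (≡.sym (ℕₚ.m+[n∸m]≡n e≤l)) ⟩
  length (filterᵇ Q (applyUpTo (s +ℕ_) (e +ℕ (l ∸ e))))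
    ≡⟨ ≡.cong (length ∘ filterᵇ Q) (applyUpTo-+ (s +ℕ_) e (l ∸ e)) ⟩
  length (filterᵇ Q (applyUpTo (s +ℕ_) e ++ applyUpTo (λ x → s +ℕ (e +ℕ x)) (l ∸ e)))
    ≡⟨ ≡.cong length (filterᵇ-++ Q (applyUpTo (s +ℕ_) e) _) ⟩
  length (filterᵇ Q (applyUpTo (s +ℕ_) e) ++ filterᵇ Q (applyUpTo (λ x → s +ℕ (e +ℕ x)) (l ∸ e)))
    ≡⟨ ≡.cong₂ (λ u v → length (u ++ v))
         (filterᵇ-applyUpTo-all Q (s +ℕ_) e (λ x x<e → <ᵇ-true (ℕₚ.+-monoʳ-< s x<e)))
         (filterᵇ-applyUpTo-none Q (λ x → s +ℕ (e +ℕ x)) (l ∸ e) (λ x _ → <ᵇ-false (ℕₚ.+-monoʳ-≤ s (ℕₚ.m≤m+n e x)))) ⟩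
  length (applyUpTo (s +ℕ_) e ++ [])
    ≡⟨ ≡.cong length (Listₚ.++-identityʳ (applyUpTo (s +ℕ_) e)) ⟩
  length (applyUpTo (s +ℕ_) e)
    ≡⟨ Listₚ.length-applyUpTo _ e ⟩
  e ∎
  where
  open ≡.≡-Reasoning
  Q : ℕ → Bool
  Q = _<ᵇ s +ℕ e

filterᵇ-const-false : ∀ {A : Set} (xs : List A) → filterᵇ (λ _ → false) xs ≡ []
filterᵇ-const-false []       = ≡.refl
filterᵇ-const-false (x ∷ xs) = filterᵇ-const-false xs

map-toℕ-filterᵇ : ∀ {m} (S : Fin m → Bool) (Q : ℕ → Bool) xs → (∀ i → S i ≡ Q (toℕ i)) →
  map toℕ (filterᵇ S xs) ≡ filterᵇ Q (map toℕ xs)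
map-toℕ-filterᵇ S Q []       h = ≡.refl
map-toℕ-filterᵇ S Q (x ∷ xs) h with S x | Q (toℕ x) | h x
... | true  | true  | _ = ≡.cong (toℕ x ∷_) (map-toℕ-filterᵇ S Q xs h)
... | false | false | _ = map-toℕ-filterᵇ S Q xs h

map-toℕ-tabulate : ∀ {m q} (f : Fin m → Fin q) (g : ℕ → ℕ) → (∀ i → toℕ (f i) ≡ g (toℕ i)) →
  map toℕ (tabulate f) ≡ applyUpTo g m
map-toℕ-tabulate {zero}  f g h = ≡.refl
map-toℕ-tabulate {suc m} f g h = ≡.cong₂ _∷_ (h fzero) (map-toℕ-tabulate (f ∘ fsuc) (g ∘ suc) (h ∘ fsuc))

map-toℕ-allFin : ∀ m → map toℕ (allFin m) ≡ upTo m
map-toℕ-allFin m = map-toℕ-tabulate (λ i → i) (λ x → x) (λ _ → ≡.refl)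

-- `nth xs i` is the i-th entry of xs (0 out of range).

nth : List ℕ → ℕ → ℕ
nth []       _       = 0
nth (x ∷ xs) zero    = x
nth (x ∷ xs) (suc i) = nth xs i

nth-applyUpTo : ∀ (g : ℕ → ℕ) p {x} → x < p → nth (applyUpTo g p) x ≡ g x
nth-applyUpTo g (suc p) {zero}  _         = ≡.refl
nth-applyUpTo g (suc p) {suc x} (s≤s x<p) = nth-applyUpTo (g ∘ suc) p x<p

nth-applyUpTo-++ˡ : ∀ (g : ℕ → ℕ) p ys {x} → x < p → nth (applyUpTo g p ++ ys) x ≡ g x
nth-applyUpTo-++ˡ g (suc p) ys {zero}  _         = ≡.refl
nth-applyUpTo-++ˡ g (suc p) ys {suc x} (s≤s x<p) = nth-applyUpTo-++ˡ (g ∘ suc) p ys x<p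

nth-applyUpTo-++ʳ : ∀ (g : ℕ → ℕ) p ys y → nth (applyUpTo g p ++ ys) (p +ℕ y) ≡ nth ys y
nth-applyUpTo-++ʳ g zero    ys y = ≡.refl
nth-applyUpTo-++ʳ g (suc p) ys y = nth-applyUpTo-++ʳ (g ∘ suc) p ys y

nth-map-toℕ-removeAt : ∀ {n} (cs : List (Fin n)) j b → nth (map toℕ (removeAt cs j)) b ≡ nth (map toℕ cs) (punchIn (toℕ j) b)
nth-map-toℕ-removeAt (c ∷ cs) fzero    b       = ≡.refl
nth-map-toℕ-removeAt (c ∷ cs) (fsuc j) zero    = ≡.refl
nth-map-toℕ-removeAt (c ∷ cs) (fsuc j) (suc b) = nth-map-toℕ-removeAt cs j b

nth-map-toℕ-lookup : ∀ {n} (cs : List (Fin n)) j → nth (map toℕ cs) (toℕ j) ≡ toℕ (lookup cs j)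
nth-map-toℕ-lookup (c ∷ cs) fzero    = ≡.refl
nth-map-toℕ-lookup (c ∷ cs) (fsuc j) = nth-map-toℕ-lookup cs j

intervalℕ : ℕ → ℕ → ℕ → Bool
intervalℕ lo hi x = (lo ≤ᵇ x) ∧ (x <ᵇ hi)

pairℕ : ℕ → ℕ → ℕ → Bool
pairℕ p q x = (x ≡ᵇ p) ∨ (x ≡ᵇ q)

quadℕ : ℕ → ℕ → ℕ → ℕ → ℕ → Bool
quadℕ p q p' q' x = pairℕ p q x ∨ pairℕ p' q' x

_Δℕ_ : (ℕ → Bool) → (ℕ → Bool) → ℕ → Bool
(P Δℕ Q) x = P x xor Q x

module BlockIndices (k₀ r : ℕ) where

  k size : ℕ
  k    = suc k₀
  size = k +ℕ (k +ℕ r)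

  Sℕ Tℕ : ℕ → Bool
  Sℕ = intervalℕ 0 k
  Tℕ = intervalℕ k (2 *ℕ k)

  filterᵇ-upTo-blocks : ∀ (Q : ℕ → Bool) → filterᵇ Q (upTo size) ≡
    filterᵇ Q (applyUpTo (λ x → x) k) ++ (filterᵇ Q (applyUpTo (k +ℕ_) k) ++ filterᵇ Q (applyUpTo (λ x → k +ℕ (k +ℕ x)) r))
  filterᵇ-upTo-blocks Q = ≡.trans (≡.cong (filterᵇ Q) (applyUpTo-+ (λ x → x) k (k +ℕ r)))
    (≡.trans (filterᵇ-++ Q (applyUpTo (λ x → x) k) _)
      (≡.cong (filterᵇ Q (applyUpTo (λ x → x) k) ++_)
        (≡.trans (≡.cong (filterᵇ Q) (applyUpTo-+ (k +ℕ_) k r)) (filterᵇ-++ Q (applyUpTo (k +ℕ_) k) _))))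

  k≤k+ : ∀ y → k ≤ k +ℕ y
  k≤k+ = ℕₚ.m≤m+n k

  <k⇒<k+ : ∀ {x} y → x < k → x < k +ℕ y
  <k⇒<k+ y x<k = ℕₚ.≤-trans x<k (k≤k+ y)

  k+<2k : ∀ {y} → y < k → k +ℕ y < 2 *ℕ k
  k+<2k {y} y<k = ≡.subst (λ z → k +ℕ y < k +ℕ z) (≡.sym (ℕₚ.+-identityʳ k)) (ℕₚ.+-monoʳ-< k y<k)

  2k≤k+k+ : ∀ z → 2 *ℕ k ≤ k +ℕ (k +ℕ z)
  2k≤k+k+ z = ≡.subst (_≤ k +ℕ (k +ℕ z)) (≡.cong (k +ℕ_) (≡.sym (ℕₚ.+-identityʳ k))) (ℕₚ.+-monoʳ-≤ k (k≤k+ z))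

  Sℕ-S : ∀ {x} → x < k → Sℕ x ≡ true
  Sℕ-S = <ᵇ-true

  Sℕ-T : ∀ y → Sℕ (k +ℕ y) ≡ false
  Sℕ-T y = <ᵇ-false (k≤k+ y)

  Sℕ-rest : ∀ z → Sℕ (k +ℕ (k +ℕ z)) ≡ false
  Sℕ-rest z = <ᵇ-false (k≤k+ (k +ℕ z))

  Tℕ-S : ∀ {x} → x < k → Tℕ x ≡ false
  Tℕ-S {x} x<k rewrite ≤ᵇ-false {k} {x} x<k = ≡.refl

  Tℕ-T : ∀ {y} → y < k → Tℕ (k +ℕ y) ≡ true
  Tℕ-T {y} y<k rewrite ≤ᵇ-true {k} {k +ℕ y} (k≤k+ y) | <ᵇ-true (k+<2k y<k) = ≡.refl

  Tℕ-rest : ∀ z → Tℕ (k +ℕ (k +ℕ z)) ≡ false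
  Tℕ-rest z rewrite ≤ᵇ-true {k} {k +ℕ (k +ℕ z)} (k≤k+ (k +ℕ z)) | <ᵇ-false (2k≤k+k+ z) = ≡.refl

  filterᵇ-Sℕ : filterᵇ Sℕ (upTo size) ≡ applyUpTo (λ x → x) k
  filterᵇ-Sℕ = ≡.trans (filterᵇ-upTo-blocks Sℕ) (≡.trans (≡.cong₂ _++_
    (filterᵇ-applyUpTo-all Sℕ (λ x → x) k (λ x → Sℕ-S))
    (≡.cong₂ _++_ (filterᵇ-applyUpTo-none Sℕ (k +ℕ_) k (λ y _ → Sℕ-T y))
                  (filterᵇ-applyUpTo-none Sℕ (λ x → k +ℕ (k +ℕ x)) r (λ z _ → Sℕ-rest z)))) (Listₚ.++-identityʳ _))

  filterᵇ-Tℕ : filterᵇ Tℕ (upTo size) ≡ applyUpTo (k +ℕ_) k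
  filterᵇ-Tℕ = ≡.trans (filterᵇ-upTo-blocks Tℕ) (≡.cong₂ _++_
    (filterᵇ-applyUpTo-none Tℕ (λ x → x) k (λ x → Tℕ-S))
    (≡.trans (≡.cong₂ _++_ (filterᵇ-applyUpTo-all Tℕ (k +ℕ_) k (λ y → Tℕ-T))
                           (filterᵇ-applyUpTo-none Tℕ (λ x → k +ℕ (k +ℕ x)) r (λ z _ → Tℕ-rest z)))
             (Listₚ.++-identityʳ _)))

  ≡ᵇ-S-T : ∀ {x} a' → x < k → (x ≡ᵇ k +ℕ a') ≡ false
  ≡ᵇ-S-T a' x<k = ≡ᵇ-false (ℕₚ.<⇒≢ (<k⇒<k+ a' x<k))

  ≡ᵇ-T-S : ∀ y {a} → a < k → (k +ℕ y ≡ᵇ a) ≡ false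
  ≡ᵇ-T-S y a<k = ≡ᵇ-false (ℕₚ.>⇒≢ (<k⇒<k+ y a<k))

  ≡ᵇ-T-T : ∀ {y a'} → y ≢ a' → (k +ℕ y ≡ᵇ k +ℕ a') ≡ false
  ≡ᵇ-T-T {y} {a'} y≢a' = ≡.trans (≡ᵇ-+ˡ k y a') (≡ᵇ-false y≢a')

  ≡ᵇ-rest-S : ∀ z {a} → a < k → (k +ℕ (k +ℕ z) ≡ᵇ a) ≡ false
  ≡ᵇ-rest-S z a<k = ≡ᵇ-false (ℕₚ.>⇒≢ (<k⇒<k+ (k +ℕ z) a<k))

  ≡ᵇ-rest-T : ∀ z {a'} → a' < k → (k +ℕ (k +ℕ z) ≡ᵇ k +ℕ a') ≡ false
  ≡ᵇ-rest-T z {a'} a'<k = ≡.trans (≡ᵇ-+ˡ k (k +ℕ z) a') (≡ᵇ-false (ℕₚ.>⇒≢ (<k⇒<k+ z a'<k)))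

  module PairExchange {a a' : ℕ} (a<k : a < k) (a'<k : a' < k) where

    Pℕ : ℕ → Bool
    Pℕ = pairℕ a (k +ℕ a')

    Pℕ-S : ∀ {x} → x < k → x ≢ a → Pℕ x ≡ false
    Pℕ-S x<k x≢a = ≡.cong₂ _∨_ (≡ᵇ-false x≢a) (≡ᵇ-S-T a' x<k)

    Pℕ-a : Pℕ a ≡ true
    Pℕ-a = ≡.cong₂ _∨_ (≡ᵇ-refl a) (≡ᵇ-S-T a' a<k)

    Pℕ-T : ∀ {y} → y ≢ a' → Pℕ (k +ℕ y) ≡ false
    Pℕ-T {y} y≢a' = ≡.cong₂ _∨_ (≡ᵇ-T-S y a<k) (≡ᵇ-T-T y≢a')

    Pℕ-a' : Pℕ (k +ℕ a') ≡ true
    Pℕ-a' = ≡.cong₂ _∨_ (≡ᵇ-T-S a' a<k) (≡ᵇ-refl (k +ℕ a'))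

    Pℕ-rest : ∀ z → Pℕ (k +ℕ (k +ℕ z)) ≡ false
    Pℕ-rest z = ≡.cong₂ _∨_ (≡ᵇ-rest-S z a<k) (≡ᵇ-rest-T z a'<k)

    filterᵇ-SℕΔPℕ : filterᵇ (Sℕ Δℕ Pℕ) (upTo size) ≡ applyUpTo (punchIn a) k₀ ++ (k +ℕ a') ∷ []
    filterᵇ-SℕΔPℕ = ≡.trans (filterᵇ-upTo-blocks Q) (≡.cong₂ _++_
      (≡.trans (filterᵇ-applyUpTo-skip Q (λ x → x) k₀ a (ℕₚ.≤-pred a<k) (≡.cong₂ _xor_ (Sℕ-S a<k) Pℕ-a))
               (filterᵇ-applyUpTo-all Q (punchIn a) k₀ (λ x x<k₀ → let a↑x<k = punchIn-<-suc a x<k₀ in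
                  ≡.cong₂ _xor_ (Sℕ-S a↑x<k) (Pℕ-S a↑x<k (punchInⱼ≢j a x)))))
      (≡.cong₂ _++_
        (filterᵇ-applyUpTo-single Q (k +ℕ_) k a' a'<k (≡.cong₂ _xor_ (Sℕ-T a') Pℕ-a')
          (λ y _ y≢a' → ≡.cong₂ _xor_ (Sℕ-T y) (Pℕ-T y≢a')))
        (filterᵇ-applyUpTo-none Q (λ x → k +ℕ (k +ℕ x)) r (λ z _ → ≡.cong₂ _xor_ (Sℕ-rest z) (Pℕ-rest z)))))
      where Q = Sℕ Δℕ Pℕ

    filterᵇ-TℕΔPℕ : filterᵇ (Tℕ Δℕ Pℕ) (upTo size) ≡ a ∷ applyUpTo (λ x → k +ℕ punchIn a' x) k₀
    filterᵇ-TℕΔPℕ = ≡.trans (filterᵇ-upTo-blocks Q) (≡.cong₂ _++_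
      (filterᵇ-applyUpTo-single Q (λ x → x) k a a<k (≡.cong₂ _xor_ (Tℕ-S a<k) Pℕ-a)
        (λ x x<k x≢a → ≡.cong₂ _xor_ (Tℕ-S x<k) (Pℕ-S x<k x≢a)))
      (≡.trans (≡.cong₂ _++_
        (≡.trans (filterᵇ-applyUpTo-skip Q (k +ℕ_) k₀ a' (ℕₚ.≤-pred a'<k) (≡.cong₂ _xor_ (Tℕ-T a'<k) Pℕ-a'))
                 (filterᵇ-applyUpTo-all Q (λ x → k +ℕ punchIn a' x) k₀ (λ x x<k₀ →
                    ≡.cong₂ _xor_ (Tℕ-T (punchIn-<-suc a' x<k₀)) (Pℕ-T (punchInⱼ≢j a' x)))))
        (filterᵇ-applyUpTo-none Q (λ x → k +ℕ (k +ℕ x)) r (λ z _ → ≡.cong₂ _xor_ (Tℕ-rest z) (Pℕ-rest z))))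
        (Listₚ.++-identityʳ _)))
      where Q = Tℕ Δℕ Pℕ

    filterᵇ-Pℕ : filterᵇ Pℕ (upTo size) ≡ a ∷ (k +ℕ a') ∷ []
    filterᵇ-Pℕ = ≡.trans (filterᵇ-upTo-blocks Pℕ) (≡.cong₂ _++_
      (filterᵇ-applyUpTo-single Pℕ (λ x → x) k a a<k Pℕ-a (λ x → Pℕ-S))
      (≡.cong₂ _++_ (filterᵇ-applyUpTo-single Pℕ (k +ℕ_) k a' a'<k Pℕ-a' (λ y _ → Pℕ-T))
                    (filterᵇ-applyUpTo-none Pℕ (λ x → k +ℕ (k +ℕ x)) r (λ z _ → Pℕ-rest z))))

  module QuadExchange {a b a' b' k₁ : ℕ} (k₀≡ : k₀ ≡ suc k₁) (a<b : a < b) (b<k : b < k) (a'<b' : a' < b') (b'<k : b' < k) where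

    a<k : a < k
    a<k = ℕₚ.<-trans a<b b<k

    a'<k : a' < k
    a'<k = ℕₚ.<-trans a'<b' b'<k

    Qℕ : ℕ → Bool
    Qℕ = quadℕ a b (k +ℕ a') (k +ℕ b')

    Qℕ-S : ∀ {x} → x < k → x ≢ a → x ≢ b → Qℕ x ≡ false
    Qℕ-S x<k x≢a x≢b = ≡.cong₂ _∨_ (≡.cong₂ _∨_ (≡ᵇ-false x≢a) (≡ᵇ-false x≢b))
                                   (≡.cong₂ _∨_ (≡ᵇ-S-T a' x<k) (≡ᵇ-S-T b' x<k))

    Qℕ-a : Qℕ a ≡ true
    Qℕ-a = ≡.cong₂ _∨_ (≡.cong₂ _∨_ (≡ᵇ-refl a) (≡ᵇ-false (ℕₚ.<⇒≢ a<b)))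
                       (≡.cong₂ _∨_ (≡ᵇ-S-T a' a<k) (≡ᵇ-S-T b' a<k))

    Qℕ-b : Qℕ b ≡ true
    Qℕ-b = ≡.cong₂ _∨_ (≡.cong₂ _∨_ (≡ᵇ-false (ℕₚ.>⇒≢ a<b)) (≡ᵇ-refl b))
                       (≡.cong₂ _∨_ (≡ᵇ-S-T a' b<k) (≡ᵇ-S-T b' b<k))

    Qℕ-T : ∀ {y} → y ≢ a' → y ≢ b' → Qℕ (k +ℕ y) ≡ false
    Qℕ-T {y} y≢a' y≢b' = ≡.cong₂ _∨_ (≡.cong₂ _∨_ (≡ᵇ-T-S y a<k) (≡ᵇ-T-S y b<k))
                                     (≡.cong₂ _∨_ (≡ᵇ-T-T y≢a') (≡ᵇ-T-T y≢b'))

    Qℕ-a' : Qℕ (k +ℕ a') ≡ true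
    Qℕ-a' = ≡.cong₂ _∨_ (≡.cong₂ _∨_ (≡ᵇ-T-S a' a<k) (≡ᵇ-T-S a' b<k))
                        (≡.cong₂ _∨_ (≡ᵇ-refl (k +ℕ a')) (≡ᵇ-T-T (ℕₚ.<⇒≢ a'<b')))

    Qℕ-b' : Qℕ (k +ℕ b') ≡ true
    Qℕ-b' = ≡.cong₂ _∨_ (≡.cong₂ _∨_ (≡ᵇ-T-S b' a<k) (≡ᵇ-T-S b' b<k))
                        (≡.cong₂ _∨_ (≡ᵇ-T-T (ℕₚ.>⇒≢ a'<b')) (≡ᵇ-refl (k +ℕ b')))

    Qℕ-rest : ∀ z → Qℕ (k +ℕ (k +ℕ z)) ≡ false
    Qℕ-rest z = ≡.cong₂ _∨_ (≡.cong₂ _∨_ (≡ᵇ-rest-S z a<k) (≡ᵇ-rest-S z b<k))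
                            (≡.cong₂ _∨_ (≡ᵇ-rest-T z a'<k) (≡ᵇ-rest-T z b'<k))

    ≤k₁ : ∀ {x y} → x < y → y < k → x ≤ k₁
    ≤k₁ x<y y<k = ℕₚ.≤-pred (ℕₚ.≤-trans x<y (ℕₚ.≤-trans (ℕₚ.≤-pred y<k) (ℕₚ.≤-reflexive k₀≡)))

    punchIn²<k : ∀ {c d x} → x < k₁ → punchIn d (punchIn c x) < k
    punchIn²<k {c} {d} x<k₁ = punchIn-<-suc d (ℕₚ.≤-trans (punchIn-<-suc c x<k₁) (ℕₚ.≤-reflexive (≡.sym k₀≡)))

    punchIn²≢ : ∀ {c d} x → c < d → punchIn d (punchIn c x) ≢ c
    punchIn²≢ {c} {d} x c<d = punchInⱼ≢j c x ∘ punchIn≡-below c<d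

    filterᵇ-SℕΔQℕ : filterᵇ (Sℕ Δℕ Qℕ) (upTo size) ≡
      applyUpTo (λ x → punchIn b (punchIn a x)) k₁ ++ (k +ℕ a') ∷ (k +ℕ b') ∷ []
    filterᵇ-SℕΔQℕ = ≡.trans (filterᵇ-upTo-blocks Q) (≡.cong₂ _++_
      (≡.trans (filterᵇ-applyUpTo-skip Q (λ x → x) k₀ b (ℕₚ.≤-pred b<k) (≡.cong₂ _xor_ (Sℕ-S b<k) Qℕ-b))
        (≡.trans (≡.trans (≡.cong (λ p → filterᵇ Q (applyUpTo (punchIn b) p)) k₀≡)
                          (filterᵇ-applyUpTo-skip Q (punchIn b) k₁ a (≤k₁ a<b b<k)
                            (≡.subst (λ z → Q z ≡ false) (≡.sym (punchIn-< a<b)) (≡.cong₂ _xor_ (Sℕ-S a<k) Qℕ-a))))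
          (filterᵇ-applyUpTo-all Q (λ x → punchIn b (punchIn a x)) k₁ (λ x x<k₁ →
             ≡.cong₂ _xor_ (Sℕ-S (punchIn²<k {a} {b} x<k₁)) (Qℕ-S (punchIn²<k x<k₁) (punchIn²≢ x a<b) (punchInⱼ≢j b (punchIn a x)))))))
      (≡.cong₂ _++_
        (filterᵇ-applyUpTo-pair Q (k +ℕ_) k a' b' a'<b' b'<k (≡.cong₂ _xor_ (Sℕ-T a') Qℕ-a') (≡.cong₂ _xor_ (Sℕ-T b') Qℕ-b')
           (λ y _ y≢a' y≢b' → ≡.cong₂ _xor_ (Sℕ-T y) (Qℕ-T y≢a' y≢b')))
        (filterᵇ-applyUpTo-none Q (λ x → k +ℕ (k +ℕ x)) r (λ z _ → ≡.cong₂ _xor_ (Sℕ-rest z) (Qℕ-rest z)))))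
      where Q = Sℕ Δℕ Qℕ

    filterᵇ-TℕΔQℕ : filterᵇ (Tℕ Δℕ Qℕ) (upTo size) ≡ a ∷ b ∷ applyUpTo (λ x → k +ℕ punchIn b' (punchIn a' x)) k₁
    filterᵇ-TℕΔQℕ = ≡.trans (filterᵇ-upTo-blocks Q) (≡.cong₂ _++_
      (filterᵇ-applyUpTo-pair Q (λ x → x) k a b a<b b<k (≡.cong₂ _xor_ (Tℕ-S a<k) Qℕ-a) (≡.cong₂ _xor_ (Tℕ-S b<k) Qℕ-b)
         (λ x x<k x≢a x≢b → ≡.cong₂ _xor_ (Tℕ-S x<k) (Qℕ-S x<k x≢a x≢b)))
      (≡.trans (≡.cong₂ _++_
        (≡.trans (filterᵇ-applyUpTo-skip Q (k +ℕ_) k₀ b' (ℕₚ.≤-pred b'<k) (≡.cong₂ _xor_ (Tℕ-T b'<k) Qℕ-b'))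
          (≡.trans (≡.trans (≡.cong (λ p → filterᵇ Q (applyUpTo (λ x → k +ℕ punchIn b' x) p)) k₀≡)
                            (filterᵇ-applyUpTo-skip Q (λ x → k +ℕ punchIn b' x) k₁ a' (≤k₁ a'<b' b'<k)
                              (≡.subst (λ z → Q (k +ℕ z) ≡ false) (≡.sym (punchIn-< a'<b')) (≡.cong₂ _xor_ (Tℕ-T a'<k) Qℕ-a'))))
            (filterᵇ-applyUpTo-all Q (λ x → k +ℕ punchIn b' (punchIn a' x)) k₁ (λ x x<k₁ →
               ≡.cong₂ _xor_ (Tℕ-T (punchIn²<k {a'} {b'} x<k₁)) (Qℕ-T (punchIn²≢ x a'<b') (punchInⱼ≢j b' (punchIn a' x)))))))
        (filterᵇ-applyUpTo-none Q (λ x → k +ℕ (k +ℕ x)) r (λ z _ → ≡.cong₂ _xor_ (Tℕ-rest z) (Qℕ-rest z))))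
        (Listₚ.++-identityʳ _)))
      where Q = Tℕ Δℕ Qℕ

    filterᵇ-Qℕ : filterᵇ Qℕ (upTo size) ≡ a ∷ b ∷ (k +ℕ a') ∷ (k +ℕ b') ∷ []
    filterᵇ-Qℕ = ≡.trans (filterᵇ-upTo-blocks Qℕ) (≡.cong₂ _++_
      (filterᵇ-applyUpTo-pair Qℕ (λ x → x) k a b a<b b<k Qℕ-a Qℕ-b (λ x → Qℕ-S))
      (≡.cong₂ _++_ (filterᵇ-applyUpTo-pair Qℕ (k +ℕ_) k a' b' a'<b' b'<k Qℕ-a' Qℕ-b' (λ y _ → Qℕ-T))
                    (filterᵇ-applyUpTo-none Qℕ (λ x → k +ℕ (k +ℕ x)) r (λ z _ → Qℕ-rest z))))

update : (ℕ → ℕ) → ℕ → ℕ → ℕ → ℕ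
update u a w x = if x ≡ᵇ a then w else u x

update-same : ∀ u a w → update u a w a ≡ w
update-same u a w rewrite ≡ᵇ-refl a = ≡.refl

update-≡ : ∀ u a w z → z ≡ a → update u a w z ≡ w
update-≡ u a w z ≡.refl = update-same u a w

update-≢ : ∀ u a w z → z ≢ a → update u a w z ≡ u z
update-≢ u a w z z≢a rewrite ≡ᵇ-false z≢a = ≡.refl

update-comm : ∀ u a b w w' → a ≢ b → ∀ z → update (update u b w') a w z ≡ update (update u a w) b w' z
update-comm u a b w w' a≢b z with z ≟ a | z ≟ b
... | yes z≡a | yes z≡b = ⊥-elim (a≢b (≡.trans (≡.sym z≡a) z≡b))
... | yes z≡a | no  z≢b = ≡.trans (update-≡ (update u b w') a w z z≡a) (≡.sym (≡.trans (update-≢ (update u a w) b w' z z≢b) (update-≡ u a w z z≡a)))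
... | no  z≢a | yes z≡b = ≡.trans (update-≢ (update u b w') a w z z≢a) (≡.trans (update-≡ u b w' z z≡b) (≡.sym (update-≡ (update u a w) b w' z z≡b)))
... | no  z≢a | no  z≢b = ≡.trans (update-≢ (update u b w') a w z z≢a) (≡.trans (update-≢ u b w' z z≢b)
                            (≡.sym (≡.trans (update-≢ (update u a w) b w' z z≢b) (update-≢ u a w z z≢a))))

swapIdx : ℕ → ℕ → ℕ → ℕ
swapIdx i i' = update (update (λ x → x) i' i) i i'

swapIdx-ˡ : ∀ i i' z → z ≡ i → swapIdx i i' z ≡ i'
swapIdx-ˡ i i' = update-≡ (update (λ x → x) i' i) i i'

swapIdx-ʳ : ∀ i i' z → z ≢ i → z ≡ i' → swapIdx i i' z ≡ i
swapIdx-ʳ i i' z z≢i z≡i' = ≡.trans (update-≢ (update (λ x → x) i' i) i i' z z≢i) (update-≡ (λ x → x) i' i z z≡i')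

swapIdx-≢ : ∀ i i' z → z ≢ i → z ≢ i' → swapIdx i i' z ≡ z
swapIdx-≢ i i' z z≢i z≢i' = ≡.trans (update-≢ (update (λ x → x) i' i) i i' z z≢i) (update-≢ (λ x → x) i' i z z≢i')

swapIdx-comm : ∀ i i' → i ≢ i' → ∀ z → swapIdx i i' z ≡ swapIdx i' i z
swapIdx-comm i i' i≢i' z with z ≟ i | z ≟ i'
... | yes z≡i | yes z≡i' = ⊥-elim (i≢i' (≡.trans (≡.sym z≡i) z≡i'))
... | yes z≡i | no  z≢i' = ≡.trans (swapIdx-ˡ i i' z z≡i) (≡.sym (swapIdx-ʳ i' i z z≢i' z≡i))
... | no  z≢i | yes z≡i' = ≡.trans (swapIdx-ʳ i i' z z≢i z≡i') (≡.sym (swapIdx-ˡ i' i z z≡i'))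
... | no  z≢i | no  z≢i' = ≡.trans (swapIdx-≢ i i' z z≢i z≢i') (≡.sym (swapIdx-≢ i' i z z≢i' z≢i))

update²-swapIdx : ∀ u a b w₁ w₂ → a ≢ b → ∀ z → update (update u b w₁) a w₂ z ≡ update (update u b w₂) a w₁ (swapIdx a b z)
update²-swapIdx u a b w₁ w₂ a≢b z with z ≟ a | z ≟ b
... | yes z≡a | yes z≡b = ⊥-elim (a≢b (≡.trans (≡.sym z≡a) z≡b))
... | yes z≡a | no  z≢b = ≡.trans (update-≡ (update u b w₁) a w₂ z z≡a) (≡.sym (≡.trans (≡.cong (update (update u b w₂) a w₁) (swapIdx-ˡ a b z z≡a))
                            (≡.trans (update-≢ (update u b w₂) a w₁ b (a≢b ∘ ≡.sym)) (update-same u b w₂))))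
... | no  z≢a | yes z≡b = ≡.trans (update-≢ (update u b w₁) a w₂ z z≢a) (≡.trans (update-≡ u b w₁ z z≡b)
                            (≡.sym (≡.trans (≡.cong (update (update u b w₂) a w₁) (swapIdx-ʳ a b z z≢a z≡b)) (update-same (update u b w₂) a w₁))))
... | no  z≢a | no  z≢b = ≡.trans (update-≢ (update u b w₁) a w₂ z z≢a) (≡.trans (update-≢ u b w₁ z z≢b)
                            (≡.sym (≡.trans (≡.cong (update (update u b w₂) a w₁) (swapIdx-≢ a b z z≢a z≢b))
                              (≡.trans (update-≢ (update u b w₂) a w₁ z z≢a) (update-≢ u b w₂ z z≢b)))))

moveToFront : ℕ → ℕ → ℕ
moveToFront i zero    = i
moveToFront i (suc a) = punchIn i a

module Sums {c ℓ : Level} (R : CommutativeRing c ℓ) where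

  open CommutativeRing R hiding (zero)
  open import Relation.Binary.Reasoning.Setoid setoid
  open import Algebra.Properties.Ring ring using (-‿distribˡ-*; -‿distribʳ-*; -‿involutive; -‿+-comm; -0#≈0#)
  open import Algebra.Solver.Ring.NaturalCoefficients.Default commutativeSemiring using (solve; _:+_; _:*_; _:=_)

  sign : ℕ → Carrier
  sign = sgn R

  fromℕ : ℕ → Carrier
  fromℕ = nat R

  -x*y≈-xy : ∀ x y → - x * y ≈ - (x * y)
  -x*y≈-xy x y = sym (-‿distribˡ-* x y)

  x*-y≈-xy : ∀ x y → x * - y ≈ - (x * y)
  x*-y≈-xy x y = sym (-‿distribʳ-* x y)

  -x*-y≈xy : ∀ x y → - x * - y ≈ x * y
  -x*-y≈xy x y = trans (-x*y≈-xy x (- y)) (trans (-‿cong (x*-y≈-xy x y)) (-‿involutive (x * y)))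

  sign-+ : ∀ a b → sign (a +ℕ b) ≈ sign a * sign b
  sign-+ zero    b = sym (*-identityˡ (sign b))
  sign-+ (suc a) b = trans (-‿cong (sign-+ a b)) (sym (-x*y≈-xy (sign a) (sign b)))

  sign-squared : ∀ a → sign a * sign a ≈ 1#
  sign-squared zero    = *-identityˡ 1#
  sign-squared (suc a) = trans (-x*-y≈xy (sign a) (sign a)) (sign-squared a)

  sign-double : ∀ a → sign (a +ℕ a) ≈ 1#
  sign-double a = trans (sign-+ a a) (sign-squared a)

  sign-cancel : ∀ i {x y} → x ≈ sign i * y → sign i * x ≈ y
  sign-cancel i {x} {y} e = trans (*-congˡ e) (trans (sym (*-assoc _ _ _)) (trans (*-congʳ (sign-squared i)) (*-identityˡ y)))

  fromℕ-+ : ∀ a b → fromℕ (a +ℕ b) ≈ fromℕ a + fromℕ b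
  fromℕ-+ zero    b = sym (+-identityˡ _)
  fromℕ-+ (suc a) b = trans (+-congˡ (fromℕ-+ a b)) (sym (+-assoc _ _ _))

  fromℕ-* : ∀ a b → fromℕ (a *ℕ b) ≈ fromℕ a * fromℕ b
  fromℕ-* zero    b = sym (zeroˡ _)
  fromℕ-* (suc a) b = trans (fromℕ-+ b (a *ℕ b)) (trans (+-cong (sym (*-identityˡ _)) (fromℕ-* a b)) (sym (distribʳ _ _ _)))

  x+x≈2x : ∀ x → x + x ≈ fromℕ 2 * x
  x+x≈2x x = sym (trans (distribʳ x 1# (1# + 0#))
    (+-cong (*-identityˡ x) (trans (distribʳ x 1# 0#) (trans (+-cong (*-identityˡ x) (zeroˡ x)) (+-identityʳ x)))))

  -- Σ p f = f 0 + … + f (p - 1); abstract, since unification would otherwise unfold it and fail to infer the summands.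
  abstract
    Σ : ℕ → (ℕ → Carrier) → Carrier
    Σ zero    f = 0#
    Σ (suc p) f = f 0 + Σ p (f ∘ suc)

    Σ-suc : ∀ p f → Σ (suc p) f ≈ f 0 + Σ p (f ∘ suc)
    Σ-suc p f = refl

    Σ-zero : ∀ f → Σ zero f ≈ 0#
    Σ-zero f = refl

    Σ-cong : ∀ p {f g : ℕ → Carrier} → (∀ x → x < p → f x ≈ g x) → Σ p f ≈ Σ p g
    Σ-cong zero    e = refl
    Σ-cong (suc p) e = +-cong (e 0 (s≤s z≤n)) (Σ-cong p (λ x x<p → e (suc x) (s≤s x<p)))

    Σ-+ : ∀ p f g → Σ p (λ x → f x + g x) ≈ Σ p f + Σ p g
    Σ-+ zero    f g = sym (+-identityˡ 0#)
    Σ-+ (suc p) f g = trans (+-congˡ (Σ-+ p _ _))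
      (solve 4 (λ a b c d → (a :+ b) :+ (c :+ d) := (a :+ c) :+ (b :+ d)) refl (f 0) (g 0) (Σ p _) (Σ p _))

    Σ-*ˡ : ∀ p a f → a * Σ p f ≈ Σ p (λ x → a * f x)
    Σ-*ˡ zero    a f = zeroʳ a
    Σ-*ˡ (suc p) a f = trans (distribˡ a (f 0) _) (+-congˡ (Σ-*ˡ p a _))

    Σ-neg : ∀ p f → - Σ p f ≈ Σ p (λ x → - f x)
    Σ-neg zero    f = -0#≈0#
    Σ-neg (suc p) f = trans (sym (-‿+-comm _ _)) (+-congˡ (Σ-neg p _))

    Σ-0 : ∀ p {f} → (∀ x → x < p → f x ≈ 0#) → Σ p f ≈ 0#
    Σ-0 zero    e = refl
    Σ-0 (suc p) e = trans (+-cong (e 0 (s≤s z≤n)) (Σ-0 p (λ x x<p → e (suc x) (s≤s x<p)))) (+-identityˡ 0#)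

    Σ-swap : ∀ p q (f : ℕ → ℕ → Carrier) → Σ p (λ x → Σ q (f x)) ≈ Σ q (λ y → Σ p (λ x → f x y))
    Σ-swap zero    q f = sym (Σ-0 q (λ _ _ → refl))
    Σ-swap (suc p) q f = trans (+-congˡ (Σ-swap p q (f ∘ suc))) (sym (Σ-+ q (f 0) (λ y → Σ p (λ x → f (suc x) y))))

    Σ-const : ∀ p a → Σ p (λ _ → a) ≈ fromℕ p * a
    Σ-const zero    a = sym (zeroˡ a)
    Σ-const (suc p) a = trans (+-congˡ (Σ-const p a)) (trans (+-congʳ (sym (*-identityˡ a))) (sym (distribʳ a 1# (fromℕ p))))

  Σ-cong′ : ∀ p {f g : ℕ → Carrier} → (∀ x → f x ≈ g x) → Σ p f ≈ Σ p g
  Σ-cong′ p e = Σ-cong p (λ x _ → e x)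

  Σ-*ʳ : ∀ p a f → Σ p f * a ≈ Σ p (λ x → f x * a)
  Σ-*ʳ p a f = trans (*-comm _ a) (trans (Σ-*ˡ p a f) (Σ-cong′ p (λ x → *-comm a (f x))))

  Σ-*-Σ : ∀ p q (f g : ℕ → Carrier) → Σ p f * Σ q g ≈ Σ p (λ x → Σ q (λ y → f x * g y))
  Σ-*-Σ p q f g = trans (Σ-*ʳ p (Σ q g) f) (Σ-cong′ p (λ x → Σ-*ˡ q (f x) g))

  Σ²-+ : ∀ p q (f g : ℕ → ℕ → Carrier) → Σ p (λ a → Σ q (λ b → f a b + g a b)) ≈ Σ p (λ a → Σ q (f a)) + Σ p (λ a → Σ q (g a))
  Σ²-+ p q f g = trans (Σ-cong′ p (λ a → Σ-+ q (f a) (g a))) (Σ-+ p (λ a → Σ q (f a)) (λ a → Σ q (g a)))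

  Σ²-Σ²-swap : ∀ p (T : ℕ → ℕ → ℕ → ℕ → Carrier) →
    Σ p (λ c → Σ p (λ c' → Σ p (λ i → Σ p (λ i' → T i i' c c')))) ≈
    Σ p (λ i → Σ p (λ i' → Σ p (λ c → Σ p (λ c' → T i i' c c'))))
  Σ²-Σ²-swap p T = begin
    Σ p (λ c → Σ p (λ c' → Σ p (λ i → Σ p (λ i' → T i i' c c'))))
      ≈⟨ Σ-cong′ p (λ c → Σ-swap p p (λ c' i → Σ p (λ i' → T i i' c c'))) ⟩
    Σ p (λ c → Σ p (λ i → Σ p (λ c' → Σ p (λ i' → T i i' c c'))))
      ≈⟨ Σ-swap p p (λ c i → Σ p (λ c' → Σ p (λ i' → T i i' c c'))) ⟩
    Σ p (λ i → Σ p (λ c → Σ p (λ c' → Σ p (λ i' → T i i' c c'))))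
      ≈⟨ Σ-cong′ p (λ i → Σ-cong′ p (λ c → Σ-swap p p (λ c' i' → T i i' c c'))) ⟩
    Σ p (λ i → Σ p (λ c → Σ p (λ i' → Σ p (λ c' → T i i' c c'))))
      ≈⟨ Σ-cong′ p (λ i → Σ-swap p p (λ c i' → Σ p (λ c' → T i i' c c'))) ⟩
    Σ p (λ i → Σ p (λ i' → Σ p (λ c → Σ p (λ c' → T i i' c c')))) ∎

  Σ-punchIn : ∀ p j f → j ≤ p → Σ (suc p) f ≈ f j + Σ p (f ∘ punchIn j)
  Σ-punchIn p       zero    f _         = Σ-suc p f
  Σ-punchIn (suc p) (suc j) f (s≤s j≤p) = trans (Σ-suc (suc p) f) (trans (+-congˡ (Σ-punchIn p j (f ∘ suc) j≤p))
    (trans (solve 3 (λ a b c → a :+ (b :+ c) := b :+ (a :+ c)) refl (f 0) (f (suc j)) (Σ p (λ x → f (suc (punchIn j x)))))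
      (+-congˡ (sym (Σ-suc p (f ∘ punchIn (suc j)))))))

  Σ-punchIn′ : ∀ p j f → j ≤ p → Σ p (f ∘ punchIn j) ≈ Σ (suc p) f - f j
  Σ-punchIn′ p j f j≤p = begin
    Σ p (f ∘ punchIn j)                  ≈⟨ sym (+-identityʳ _) ⟩
    Σ p (f ∘ punchIn j) + 0#             ≈⟨ +-congˡ (sym (-‿inverseʳ (f j))) ⟩
    Σ p (f ∘ punchIn j) + (f j - f j)    ≈⟨ solve 3 (λ a b c → a :+ (b :+ c) := (b :+ a) :+ c) refl (Σ p (f ∘ punchIn j)) (f j) (- f j) ⟩
    (f j + Σ p (f ∘ punchIn j)) - f j    ≈⟨ +-congʳ (sym (Σ-punchIn p j f j≤p)) ⟩
    Σ (suc p) f - f j ∎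

  -- Re-enumerates the ordered pairs (j, punchIn j l) of distinct indices by their second entry.
  Σ-distinctPairs : ∀ p (Φ : ℕ → ℕ → Carrier) →
    Σ (suc p) (λ j → Σ p (Φ j)) ≈ Σ (suc p) (λ c → Σ p (λ d → Φ (punchIn c d) (punchOut (punchIn c d) c)))
  Σ-distinctPairs p Φ = begin
    Σ (suc p) (λ j → Σ p (Φ j))
      ≈⟨ Σ-cong (suc p) (λ j j<sp → trans (Σ-cong′ p (λ l → reflexive (≡.cong (Φ j) (≡.sym (punchOut-punchIn j l)))))
                                            (Σ-punchIn′ p j (Φ̃ j) (ℕₚ.≤-pred j<sp))) ⟩
    Σ (suc p) (λ j → Σ (suc p) (Φ̃ j) - Φ̃ j j)
      ≈⟨ Σ-+ (suc p) (λ j → Σ (suc p) (Φ̃ j)) (λ j → - Φ̃ j j) ⟩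
    Σ (suc p) (λ j → Σ (suc p) (Φ̃ j)) + Σ (suc p) (λ j → - Φ̃ j j)
      ≈⟨ +-congʳ (Σ-swap (suc p) (suc p) Φ̃) ⟩
    Σ (suc p) (λ c → Σ (suc p) (λ x → Φ̃ x c)) + Σ (suc p) (λ c → - Φ̃ c c)
      ≈⟨ sym (Σ-+ (suc p) (λ c → Σ (suc p) (λ x → Φ̃ x c)) (λ c → - Φ̃ c c)) ⟩
    Σ (suc p) (λ c → Σ (suc p) (λ x → Φ̃ x c) - Φ̃ c c)
      ≈⟨ Σ-cong (suc p) (λ c c<sp → sym (Σ-punchIn′ p c (λ x → Φ̃ x c) (ℕₚ.≤-pred c<sp))) ⟩
    Σ (suc p) (λ c → Σ p (λ d → Φ (punchIn c d) (punchOut (punchIn c d) c))) ∎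
    where
    Φ̃ : ℕ → ℕ → Carrier
    Φ̃ j y = Φ j (punchOut j y)

  Σ-Σ-punchIn : ∀ p (f : ℕ → Carrier) → Σ (suc p) (λ a → Σ p (f ∘ punchIn a)) ≈ fromℕ p * Σ (suc p) f
  Σ-Σ-punchIn p f = begin
    Σ (suc p) (λ a → Σ p (f ∘ punchIn a)) ≈⟨ Σ-cong (suc p) (λ a a<sp → Σ-punchIn′ p a f (ℕₚ.≤-pred a<sp)) ⟩
    Σ (suc p) (λ a → S - f a)             ≈⟨ Σ-+ (suc p) (λ _ → S) (λ a → - f a) ⟩
    Σ (suc p) (λ _ → S) + Σ (suc p) (λ a → - f a) ≈⟨ +-cong (Σ-const (suc p) S) (sym (Σ-neg (suc p) f)) ⟩
    (1# + fromℕ p) * S - S                ≈⟨ +-congʳ (trans (distribʳ S 1# (fromℕ p)) (+-congʳ (*-identityˡ S))) ⟩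
    (S + fromℕ p * S) - S                 ≈⟨ solve 3 (λ s t u → (s :+ t) :+ u := t :+ (s :+ u)) refl S (fromℕ p * S) (- S) ⟩
    fromℕ p * S + (S - S)                 ≈⟨ +-congˡ (-‿inverseʳ S) ⟩
    fromℕ p * S + 0#                      ≈⟨ +-identityʳ _ ⟩
    fromℕ p * S ∎
    where
    S : Carrier
    S = Σ (suc p) f

  if-cong : ∀ (b : Bool) {x y : Carrier} → (b ≡ true → x ≈ y) → (if b then x else 0#) ≈ (if b then y else 0#)
  if-cong true  f = f ≡.refl
  if-cong false f = refl

  if-+ : ∀ (b : Bool) x y → (if b then x else 0#) + (if b then y else 0#) ≈ (if b then x + y else 0#)
  if-+ true  x y = refl
  if-+ false x y = +-identityˡ 0#

  if-*ˡ : ∀ (b : Bool) n x → n * (if b then x else 0#) ≈ (if b then n * x else 0#)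
  if-*ˡ true  n x = refl
  if-*ˡ false n x = zeroʳ n

  Σ-if : ∀ p (b : Bool) f → Σ p (λ x → if b then f x else 0#) ≈ (if b then Σ p f else 0#)
  Σ-if p true  f = refl
  Σ-if p false f = Σ-0 p (λ _ _ → refl)

  if-≡ᵇ-split : ∀ a b v → (if b ≡ᵇ a then 0# else v) ≈ (if a <ᵇ b then v else 0#) + (if b <ᵇ a then v else 0#)
  if-≡ᵇ-split a b v with ℕₚ.<-cmp a b
  ... | tri< a<b _ _ rewrite ≡ᵇ-false (ℕₚ.>⇒≢ a<b) | <ᵇ-true a<b | <ᵇ-false (ℕₚ.<⇒≤ a<b) = sym (+-identityʳ v)
  ... | tri≈ _ ≡.refl _ rewrite ≡ᵇ-refl a | <ᵇ-false {a} {a} ℕₚ.≤-refl = sym (+-identityˡ 0#)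
  ... | tri> _ _ b<a rewrite ≡ᵇ-false (ℕₚ.<⇒≢ b<a) | <ᵇ-true b<a | <ᵇ-false (ℕₚ.<⇒≤ b<a) = sym (+-identityˡ v)

  Σ-offDiagonal : ∀ p (f : ℕ → ℕ → Carrier) →
    Σ (suc p) (λ a → Σ p (f a ∘ punchIn a)) ≈ Σ (suc p) (λ a → Σ (suc p) (λ b → if a <ᵇ b then f a b + f b a else 0#))
  Σ-offDiagonal p f = begin
    Σ k (λ a → Σ p (f a ∘ punchIn a))
      ≈⟨ Σ-cong k (λ a a<k → sym (trans (Σ-punchIn p a (λ b → if b ≡ᵇ a then 0# else f a b) (ℕₚ.≤-pred a<k))
           (trans (+-cong (reflexive (≡.cong (λ t → if t then 0# else f a a) (≡ᵇ-refl a)))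
                          (Σ-cong′ p (λ x → reflexive (≡.cong (λ t → if t then 0# else f a (punchIn a x)) (≡ᵇ-false (punchInⱼ≢j a x))))))
             (+-identityˡ _)))) ⟩
    Σ k (λ a → Σ k (λ b → if b ≡ᵇ a then 0# else f a b))
      ≈⟨ Σ-cong′ k (λ a → Σ-cong′ k (λ b → if-≡ᵇ-split a b (f a b))) ⟩
    Σ k (λ a → Σ k (λ b → (if a <ᵇ b then f a b else 0#) + (if b <ᵇ a then f a b else 0#)))
      ≈⟨ Σ²-+ k k (λ a b → if a <ᵇ b then f a b else 0#) (λ a b → if b <ᵇ a then f a b else 0#) ⟩
    Σ k (λ a → Σ k (λ b → if a <ᵇ b then f a b else 0#)) + Σ k (λ a → Σ k (λ b → if b <ᵇ a then f a b else 0#))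
      ≈⟨ +-congˡ (Σ-swap k k (λ a b → if b <ᵇ a then f a b else 0#)) ⟩
    Σ k (λ a → Σ k (λ b → if a <ᵇ b then f a b else 0#)) + Σ k (λ b → Σ k (λ a → if b <ᵇ a then f a b else 0#))
      ≈⟨ sym (Σ²-+ k k (λ a b → if a <ᵇ b then f a b else 0#) (λ a b → if a <ᵇ b then f b a else 0#)) ⟩
    Σ k (λ a → Σ k (λ b → (if a <ᵇ b then f a b else 0#) + (if a <ᵇ b then f b a else 0#)))
      ≈⟨ Σ-cong′ k (λ a → Σ-cong′ k (λ b → if-+ (a <ᵇ b) (f a b) (f b a))) ⟩
    Σ k (λ a → Σ k (λ b → if a <ᵇ b then f a b + f b a else 0#)) ∎
    where k = suc p

  Σ-offDiagonal-symmetric : ∀ p (n : Carrier) (f d : ℕ → ℕ → Carrier) → (∀ a b → a < b → b < suc p → f a b + f b a ≈ n * d a b) →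
    Σ (suc p) (λ a → Σ p (f a ∘ punchIn a)) ≈ n * Σ (suc p) (λ a → Σ (suc p) (λ b → if a <ᵇ b then d a b else 0#))
  Σ-offDiagonal-symmetric p n f d sym-f = begin
    Σ k (λ a → Σ p (f a ∘ punchIn a)) ≈⟨ Σ-offDiagonal p f ⟩
    Σ k (λ a → Σ k (λ b → if a <ᵇ b then f a b + f b a else 0#))
      ≈⟨ Σ-cong′ k (λ a → Σ-cong k (λ b b<k → trans (if-cong (a <ᵇ b) (λ e → sym-f a b (<ᵇ-true⇒< a b e) b<k))
                                                     (sym (if-*ˡ (a <ᵇ b) n (d a b))))) ⟩
    Σ k (λ a → Σ k (λ b → n * (if a <ᵇ b then d a b else 0#)))
      ≈⟨ sym (trans (Σ-*ˡ k n _) (Σ-cong′ k (λ a → Σ-*ˡ k n _))) ⟩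
    n * Σ k (λ a → Σ k (λ b → if a <ᵇ b then d a b else 0#)) ∎
    where k = suc p

  if²-cong : ∀ {b₁ b₁' b₂ b₂' : Bool} {x y : Carrier} → b₁ ≡ b₁' → b₂ ≡ b₂' → (b₁' ≡ true → b₂' ≡ true → x ≈ y) →
    (if b₁ then (if b₂ then x else 0#) else 0#) ≈ (if b₁' then (if b₂' then y else 0#) else 0#)
  if²-cong {true}  {b₂ = true}  ≡.refl ≡.refl x≈y = x≈y ≡.refl ≡.refl
  if²-cong {true}  {b₂ = false} ≡.refl ≡.refl _   = refl
  if²-cong {false}              ≡.refl ≡.refl _   = refl

  sign-even-cancel₄ : ∀ D e₁ e₂ e₃ e₄ N {X Y} → D +ℕ (e₁ +ℕ (e₂ +ℕ (e₃ +ℕ e₄))) ≡ N +ℕ N →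
    sign D * ((sign e₁ * (sign e₂ * X)) * (sign e₃ * (sign e₄ * Y))) ≈ X * Y
  sign-even-cancel₄ D e₁ e₂ e₃ e₄ N {X} {Y} eq = begin
    sign D * ((sign e₁ * (sign e₂ * X)) * (sign e₃ * (sign e₄ * Y)))
      ≈⟨ solve 7 (λ d s₁ s₂ s₃ s₄ x y → d :* ((s₁ :* (s₂ :* x)) :* (s₃ :* (s₄ :* y))) := (d :* (s₁ :* (s₂ :* (s₃ :* s₄)))) :* (x :* y))
           refl (sign D) (sign e₁) (sign e₂) (sign e₃) (sign e₄) X Y ⟩
    (sign D * (sign e₁ * (sign e₂ * (sign e₃ * sign e₄)))) * (X * Y)
      ≈⟨ *-congʳ (sym (trans (sign-+ D _) (*-congˡ (trans (sign-+ e₁ _) (*-congˡ (trans (sign-+ e₂ _) (*-congˡ (sign-+ e₃ e₄)))))))) ⟩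
    sign (D +ℕ (e₁ +ℕ (e₂ +ℕ (e₃ +ℕ e₄)))) * (X * Y)
      ≈⟨ *-congʳ (trans (reflexive (≡.cong sign eq)) (sign-double N)) ⟩
    1# * (X * Y)
      ≈⟨ *-identityˡ _ ⟩
    X * Y ∎

  sign-even-cancel₂ : ∀ D e₁ e₂ N {X Y} → D +ℕ (e₁ +ℕ e₂) ≡ N +ℕ N → sign D * ((sign e₁ * X) * (sign e₂ * Y)) ≈ X * Y
  sign-even-cancel₂ D e₁ e₂ N {X} {Y} eq = begin
    sign D * ((sign e₁ * X) * (sign e₂ * Y))
      ≈⟨ solve 5 (λ d s₁ s₂ x y → d :* ((s₁ :* x) :* (s₂ :* y)) := (d :* (s₁ :* s₂)) :* (x :* y)) refl (sign D) (sign e₁) (sign e₂) X Y ⟩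
    (sign D * (sign e₁ * sign e₂)) * (X * Y)     ≈⟨ *-congʳ (sym (trans (sign-+ D _) (*-congˡ (sign-+ e₁ e₂)))) ⟩
    sign (D +ℕ (e₁ +ℕ e₂)) * (X * Y)             ≈⟨ *-congʳ (trans (reflexive (≡.cong sign eq)) (sign-double N)) ⟩
    1# * (X * Y)                                 ≈⟨ *-identityˡ _ ⟩
    X * Y ∎

  sign-odd-cancel₂ : ∀ K D e₁ e₂ N {X Y} → K +ℕ (D +ℕ (e₁ +ℕ e₂)) ≡ suc (N +ℕ N) →
    sign K * (sign D * ((sign e₁ * X) * (sign e₂ * Y))) ≈ - (X * Y)
  sign-odd-cancel₂ K D e₁ e₂ N {X} {Y} eq = begin
    sign K * (sign D * ((sign e₁ * X) * (sign e₂ * Y)))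
      ≈⟨ solve 6 (λ κ d s₁ s₂ x y → κ :* (d :* ((s₁ :* x) :* (s₂ :* y))) := (κ :* (d :* (s₁ :* s₂))) :* (x :* y))
           refl (sign K) (sign D) (sign e₁) (sign e₂) X Y ⟩
    (sign K * (sign D * (sign e₁ * sign e₂))) * (X * Y)
      ≈⟨ *-congʳ (sym (trans (sign-+ K _) (*-congˡ (trans (sign-+ D _) (*-congˡ (sign-+ e₁ e₂)))))) ⟩
    sign (K +ℕ (D +ℕ (e₁ +ℕ e₂))) * (X * Y)      ≈⟨ *-congʳ (trans (reflexive (≡.cong sign eq)) (-‿cong (sign-double N))) ⟩
    - 1# * (X * Y)                               ≈⟨ -x*y≈-xy _ _ ⟩
    - (1# * (X * Y))                             ≈⟨ -‿cong (*-identityˡ _) ⟩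
    - (X * Y) ∎

module Determinants {c ℓ : Level} (R : CommutativeRing c ℓ) where

  open CommutativeRing R hiding (zero)
  open import Relation.Binary.Reasoning.Setoid setoid
  open import Algebra.Properties.Ring ring using (-‿involutive)
  open import Algebra.Solver.Ring.NaturalCoefficients.Default commutativeSemiring using (solve; _:+_; _:*_; _:=_)
  open Sums R

  sign-punchIn-punchOut : ∀ c d → sign (punchIn c d) * sign (punchOut (punchIn c d) c) ≈ - (sign c * sign d)
  sign-punchIn-punchOut zero    d       = trans (*-identityʳ _) (-‿cong (sym (*-identityˡ (sign d))))
  sign-punchIn-punchOut (suc c) zero    = trans (*-identityˡ _) (trans (sym (-‿involutive (sign c))) (-‿cong (sym (*-identityʳ _))))
  sign-punchIn-punchOut (suc c) (suc d) = trans (-x*-y≈xy _ _) (trans (sign-punchIn-punchOut c d) (-‿cong (sym (-x*-y≈xy (sign c) (sign d)))))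

  Matrix : Set c
  Matrix = ℕ → ℕ → Carrier

  det : ℕ → Matrix → Carrier
  det zero B = 1#
  det (suc p) B = Σ (suc p) (λ j → sign j * (B 0 j * det p (λ a b → B (suc a) (punchIn j b))))

  det-cong : ∀ p {B B' : Matrix} → (∀ a b → a < p → b < p → B a b ≈ B' a b) → det p B ≈ det p B'
  det-cong zero e = refl
  det-cong (suc p) e = Σ-cong (suc p) (λ j j<sp → *-congˡ (*-cong (e 0 j (s≤s z≤n) j<sp)
    (det-cong p (λ a b a<p b<p → e (suc a) (punchIn j b) (s≤s a<p) (punchIn-<-suc j b<p)))))

  det-cong′ : ∀ p {B B' : Matrix} → (∀ a b → B a b ≈ B' a b) → det p B ≈ det p B'
  det-cong′ p e = det-cong p (λ a b _ _ → e a b)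

  Σ-neg-exchange : ∀ p q (u v X Y : ℕ → Carrier) (D : ℕ → ℕ → Carrier) →
    Σ p (λ j → - u j * (X j * Σ q (λ i → v i * (Y i * D i j)))) ≈
    Σ q (λ i → - v i * (Y i * Σ p (λ j → u j * (X j * D i j))))
  Σ-neg-exchange p q u v X Y D = begin
    Σ p (λ j → - u j * (X j * Σ q (λ i → v i * (Y i * D i j))))
      ≈⟨ Σ-cong′ p (λ j → trans (-x*y≈-xy _ _) (-‿cong (trans (*-congˡ (Σ-*ˡ q (X j) _)) (Σ-*ˡ q (u j) _)))) ⟩
    Σ p (λ j → - Σ q (λ i → u j * (X j * (v i * (Y i * D i j)))))
      ≈⟨ Σ-cong′ p (λ j → trans (Σ-neg q _) (Σ-cong′ q (λ i → -‿cong (K j i)))) ⟩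
    Σ p (λ j → Σ q (λ i → - ((u j * v i) * ((X j * Y i) * D i j))))
      ≈⟨ Σ-swap p q _ ⟩
    Σ q (λ i → Σ p (λ j → - ((u j * v i) * ((X j * Y i) * D i j))))
      ≈⟨ Σ-cong′ q (λ i → trans (Σ-cong′ p (λ j → -‿cong (L j i))) (sym (Σ-neg p _))) ⟩
    Σ q (λ i → - Σ p (λ j → v i * (Y i * (u j * (X j * D i j)))))
      ≈⟨ Σ-cong′ q (λ i → sym (trans (-x*y≈-xy _ _) (-‿cong (trans (*-congˡ (Σ-*ˡ p (Y i) _)) (Σ-*ˡ p (v i) _))))) ⟩
    Σ q (λ i → - v i * (Y i * Σ p (λ j → u j * (X j * D i j)))) ∎
    where
    K : ∀ j i → u j * (X j * (v i * (Y i * D i j))) ≈ (u j * v i) * ((X j * Y i) * D i j)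
    K j i = solve 5 (λ a b c d e → a :* (b :* (c :* (d :* e))) := (a :* c) :* ((b :* d) :* e)) refl (u j) (X j) (v i) (Y i) (D i j)
    L : ∀ j i → (u j * v i) * ((X j * Y i) * D i j) ≈ v i * (Y i * (u j * (X j * D i j)))
    L j i = solve 5 (λ a b c d e → (a :* c) :* ((b :* d) :* e) := c :* (d :* (a :* (b :* e)))) refl (u j) (X j) (v i) (Y i) (D i j)

  det-expand-col₀ : ∀ p (B : Matrix) → det (suc p) B ≈ Σ (suc p) (λ i → sign i * (B i 0 * det p (λ a b → B (punchIn i a) (suc b))))
  det-expand-col₀ zero B = trans (Σ-suc 0 _) (trans (+-congˡ (trans (Σ-zero (λ x → sign (suc x) * (B 0 (suc x) * 1#)))
    (sym (Σ-zero (λ x → sign (suc x) * (B (suc x) 0 * 1#)))))) (sym (Σ-suc 0 (λ i → sign i * (B i 0 * 1#)))))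
  det-expand-col₀ (suc p) B = trans (Σ-suc (suc p) _) (trans (+-congˡ (begin
    Σ (suc p) (λ j → sign (suc j) * (B 0 (suc j) * det (suc p) (λ a b → B (suc a) (punchIn (suc j) b))))
      ≈⟨ Σ-cong′ (suc p) (λ j → *-congˡ (*-congˡ (det-expand-col₀ p (λ a b → B (suc a) (punchIn (suc j) b))))) ⟩
    Σ (suc p) (λ j → - sign j * (B 0 (suc j) * Σ (suc p) (λ i → sign i * (B (suc i) 0 * det p (λ a b → B (suc (punchIn i a)) (suc (punchIn j b)))))))
      ≈⟨ Σ-neg-exchange (suc p) (suc p) sign sign (λ j → B 0 (suc j)) (λ i → B (suc i) 0) (λ i j → det p (λ a b → B (suc (punchIn i a)) (suc (punchIn j b)))) ⟩
    Σ (suc p) (λ i → sign (suc i) * (B (suc i) 0 * det (suc p) (λ a b → B (punchIn (suc i) a) (suc b)))) ∎)) (sym (Σ-suc (suc p) _)))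

  det-transpose : ∀ p (B : Matrix) → det p (λ a b → B b a) ≈ det p B
  det-transpose zero B = refl
  det-transpose (suc p) B = trans
    (Σ-cong′ (suc p) (λ j → *-congˡ (*-congˡ (det-transpose p (λ a b → B (punchIn j a) (suc b))))))
    (sym (det-expand-col₀ p B))

  det-expand-row : ∀ p i (B : Matrix) → i ≤ p →
    det (suc p) B ≈ Σ (suc p) (λ j → sign (i +ℕ j) * (B i j * det p (λ a b → B (punchIn i a) (punchIn j b))))
  det-expand-row p zero B _ = refl
  det-expand-row (suc p) (suc i) B (s≤s i≤p) = begin
    det (suc (suc p)) B
      ≈⟨ Σ-cong′ (suc (suc p)) (λ j → *-congˡ (*-congˡ (det-expand-row p i (λ a b → B (suc a) (punchIn j b)) i≤p))) ⟩
    Σ (suc (suc p)) (λ j → sign j * (B 0 j * Σ (suc p) (λ l → sign (i +ℕ l) * (B (suc i) (punchIn j l) * E j l))))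
      ≈⟨ Σ-cong′ (suc (suc p)) (λ j → trans (*-congˡ (Σ-*ˡ (suc p) (B 0 j) _)) (Σ-*ˡ (suc p) (sign j) _)) ⟩
    Σ (suc (suc p)) (λ j → Σ (suc p) (λ l → Φ j l))
      ≈⟨ Σ-distinctPairs (suc p) Φ ⟩
    Σ (suc (suc p)) (λ c → Σ (suc p) (λ d → Φ (punchIn c d) (punchOut (punchIn c d) c)))
      ≈⟨ Σ-cong′ (suc (suc p)) (λ c → Σ-cong′ (suc p) (λ d → term c d)) ⟩
    Σ (suc (suc p)) (λ c → Σ (suc p) (λ d → sign (suc i +ℕ c) * (B (suc i) c * (sign d * (B 0 (punchIn c d) * E c d)))))
      ≈⟨ Σ-cong′ (suc (suc p)) (λ c → sym (trans (*-congˡ (Σ-*ˡ (suc p) (B (suc i) c) _)) (Σ-*ˡ (suc p) (sign (suc i +ℕ c)) _))) ⟩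
    Σ (suc (suc p)) (λ c → sign (suc i +ℕ c) * (B (suc i) c * det (suc p) (λ a b → B (punchIn (suc i) a) (punchIn c b)))) ∎
    where
    E : ℕ → ℕ → Carrier
    E j l = det p (λ a b → B (suc (punchIn i a)) (punchIn j (punchIn l b)))
    Φ : ℕ → ℕ → Carrier
    Φ j l = sign j * (B 0 j * (sign (i +ℕ l) * (B (suc i) (punchIn j l) * E j l)))
    term : ∀ c d → Φ (punchIn c d) (punchOut (punchIn c d) c) ≈ sign (suc i +ℕ c) * (B (suc i) c * (sign d * (B 0 (punchIn c d) * E c d)))
    term c d = begin
      sign X * (B 0 X * (sign (i +ℕ Y) * (B (suc i) (punchIn X Y) * E X Y)))
        ≈⟨ *-congˡ (*-congˡ (*-cong (sign-+ i Y) (*-cong (reflexive (≡.cong (B (suc i)) pXY)) EE))) ⟩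
      sign X * (B 0 X * ((sign i * sign Y) * (B (suc i) c * E c d)))
        ≈⟨ solve 6 (λ x y s p1 p2 e → x :* (p1 :* ((s :* y) :* (p2 :* e))) := (x :* y) :* (s :* (p1 :* (p2 :* e)))) refl
             (sign X) (sign Y) (sign i) (B 0 X) (B (suc i) c) (E c d) ⟩
      (sign X * sign Y) * (sign i * (B 0 X * (B (suc i) c * E c d)))
        ≈⟨ *-congʳ (sign-punchIn-punchOut c d) ⟩
      - (sign c * sign d) * (sign i * (B 0 X * (B (suc i) c * E c d)))
        ≈⟨ -x*y≈-xy _ _ ⟩
      - ((sign c * sign d) * (sign i * (B 0 X * (B (suc i) c * E c d))))
        ≈⟨ -‿cong (solve 6 (λ x y s p1 p2 e → (x :* y) :* (s :* (p1 :* (p2 :* e))) := (s :* x) :* (p2 :* (y :* (p1 :* e)))) refl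
             (sign c) (sign d) (sign i) (B 0 X) (B (suc i) c) (E c d)) ⟩
      - ((sign i * sign c) * (B (suc i) c * (sign d * (B 0 X * E c d))))
        ≈⟨ -‿cong (*-congʳ (sym (sign-+ i c))) ⟩
      - (sign (i +ℕ c) * (B (suc i) c * (sign d * (B 0 X * E c d))))
        ≈⟨ sym (-x*y≈-xy _ _) ⟩
      sign (suc i +ℕ c) * (B (suc i) c * (sign d * (B 0 (punchIn c d) * E c d))) ∎
      where
      X = punchIn c d
      Y = punchOut X c
      pXY : punchIn X Y ≡ c
      pXY = punchIn-punchOut (λ e → punchInⱼ≢j c d (≡.sym e))
      EE : E X Y ≈ E c d
      EE = det-cong′ p (λ a b → reflexive (≡.cong (B (suc (punchIn i a))) (punchIn-punchIn c d b)))


  Σ-sign-+ˡ : ∀ p i (T : ℕ → Carrier) → Σ p (λ j → sign (i +ℕ j) * T j) ≈ sign i * Σ p (λ j → sign j * T j)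
  Σ-sign-+ˡ p i T = trans (Σ-cong′ p (λ j → trans (*-congʳ (sign-+ i j)) (*-assoc _ _ _))) (sym (Σ-*ˡ p (sign i) _))

  det-moveToFront : ∀ p i (B : Matrix) → i ≤ p → det (suc p) (λ a b → B (moveToFront i a) b) ≈ sign i * det (suc p) B
  det-moveToFront p i B i≤p = sym (sign-cancel i (trans (det-expand-row p i B i≤p) (Σ-sign-+ˡ (suc p) i _)))

  det-expand-col : ∀ p j (B : Matrix) → j ≤ p →
    det (suc p) B ≈ Σ (suc p) (λ i → sign (i +ℕ j) * (B i j * det p (λ a b → B (punchIn i a) (punchIn j b))))
  det-expand-col p j B j≤p = begin
    det (suc p) B ≈⟨ sym (det-transpose (suc p) B) ⟩
    det (suc p) (λ a b → B b a) ≈⟨ det-expand-row p j (λ a b → B b a) j≤p ⟩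
    Σ (suc p) (λ i → sign (j +ℕ i) * (B i j * det p (λ a b → B (punchIn i b) (punchIn j a))))
      ≈⟨ Σ-cong′ (suc p) (λ i → *-cong (reflexive (≡.cong sign (ℕₚ.+-comm j i))) (*-congˡ (det-transpose p (λ a b → B (punchIn i a) (punchIn j b))))) ⟩
    Σ (suc p) (λ i → sign (i +ℕ j) * (B i j * det p (λ a b → B (punchIn i a) (punchIn j b)))) ∎


  det-linear : ∀ p i (B₁ B₂ B₃ : Matrix) → i ≤ p →
    (∀ a b → a ≢ i → B₁ a b ≈ B₂ a b) → (∀ a b → a ≢ i → B₁ a b ≈ B₃ a b) →
    (∀ b → B₁ i b ≈ B₂ i b + B₃ i b) → det (suc p) B₁ ≈ det (suc p) B₂ + det (suc p) B₃
  det-linear p i B₁ B₂ B₃ i≤p B₁≈B₂ B₁≈B₃ rowᵢ = begin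
    det (suc p) B₁ ≈⟨ det-expand-row p i B₁ i≤p ⟩
    Σ (suc p) (λ j → sign (i +ℕ j) * (B₁ i j * minor₁ j))
      ≈⟨ Σ-cong′ (suc p) (λ j → trans (*-congˡ (trans (*-congʳ (rowᵢ j)) (distribʳ _ _ _))) (distribˡ _ _ _)) ⟩
    Σ (suc p) (λ j → sign (i +ℕ j) * (B₂ i j * minor₁ j) + sign (i +ℕ j) * (B₃ i j * minor₁ j))
      ≈⟨ Σ-+ (suc p) (λ j → sign (i +ℕ j) * (B₂ i j * minor₁ j)) (λ j → sign (i +ℕ j) * (B₃ i j * minor₁ j)) ⟩
    Σ (suc p) (λ j → sign (i +ℕ j) * (B₂ i j * minor₁ j)) + Σ (suc p) (λ j → sign (i +ℕ j) * (B₃ i j * minor₁ j))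
      ≈⟨ +-cong (Σ-cong′ (suc p) (λ j → *-congˡ (*-congˡ (det-cong′ p (λ a b → B₁≈B₂ (punchIn i a) (punchIn j b) (punchInⱼ≢j i a))))))
                (Σ-cong′ (suc p) (λ j → *-congˡ (*-congˡ (det-cong′ p (λ a b → B₁≈B₃ (punchIn i a) (punchIn j b) (punchInⱼ≢j i a)))))) ⟩
    Σ (suc p) (λ j → sign (i +ℕ j) * (B₂ i j * det p (λ a b → B₂ (punchIn i a) (punchIn j b)))) +
    Σ (suc p) (λ j → sign (i +ℕ j) * (B₃ i j * det p (λ a b → B₃ (punchIn i a) (punchIn j b))))
      ≈⟨ +-cong (sym (det-expand-row p i B₂ i≤p)) (sym (det-expand-row p i B₃ i≤p)) ⟩
    det (suc p) B₂ + det (suc p) B₃ ∎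
    where
    minor₁ : ℕ → Carrier
    minor₁ j = det p (λ a b → B₁ (punchIn i a) (punchIn j b))

  det-1 : ∀ (C : Matrix) → det 1 C ≈ C 0 0
  det-1 C = trans (Σ-suc 0 _) (trans (+-congˡ (Σ-zero _)) (trans (+-identityʳ _) (trans (*-identityˡ _) (*-identityʳ _))))

  det-2 : ∀ (B : Matrix) → det 2 B ≈ B 0 0 * B 1 1 + - (B 0 1 * B 1 0)
  det-2 B = trans (Σ-suc 1 f) (+-cong (trans (*-identityˡ _) (*-congˡ (det-1 (λ a b → B (suc a) (punchIn 0 b)))))
    (trans (Σ-suc 0 (λ x → f (suc x))) (trans (+-congˡ (Σ-zero (λ x → f (suc (suc x))))) (trans (+-identityʳ _) (trans (-x*y≈-xy _ _) (-‿cong (trans (*-identityˡ _) (*-congˡ (det-1 (λ a b → B (suc a) (punchIn 1 b)))))))))))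
    where
    f : ℕ → Carrier
    f j = sign j * (B 0 j * det 1 (λ a b → B (suc a) (punchIn j b)))

  -- When row 0 is one of the two equal rows, another row is first moved to the front.
  mutual
    det-equalRows : ∀ p i i' (B : Matrix) → i < i' → i' ≤ p → (∀ b → B i b ≈ B i' b) → det (suc p) B ≈ 0#
    det-equalRows zero i zero B () z≤n eq
    det-equalRows (suc p) (suc i) (suc i') B (s≤s i<i') (s≤s i'≤p) eq = det-equalRows-suc p i i' B i<i' i'≤p eq
    det-equalRows (suc zero) zero (suc zero) B _ _ eq = begin
      det 2 B ≈⟨ det-2 B ⟩
      B 0 0 * B 1 1 + - (B 0 1 * B 1 0) ≈⟨ +-cong (*-cong (eq 0) (sym (eq 1))) (-‿cong (*-comm _ _)) ⟩
      B 1 0 * B 0 1 + - (B 1 0 * B 0 1) ≈⟨ -‿inverseʳ _ ⟩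
      0# ∎
    det-equalRows (suc zero) zero (suc (suc i')) B _ (s≤s ()) eq
    det-equalRows (suc (suc p)) zero (suc zero) B _ _ eq = begin
      det (suc (suc (suc p))) B ≈⟨ sym (sign-cancel 2 (det-moveToFront (suc (suc p)) 2 B (s≤s (s≤s z≤n)))) ⟩
      sign 2 * det (suc (suc (suc p))) (λ a b → B (moveToFront 2 a) b) ≈⟨ *-congˡ (det-equalRows-suc (suc p) 0 1 (λ a b → B (moveToFront 2 a) b) (s≤s z≤n) (s≤s z≤n) eq) ⟩
      sign 2 * 0# ≈⟨ zeroʳ _ ⟩
      0# ∎
    det-equalRows (suc (suc p)) zero (suc (suc i')) B _ (s≤s i'≤p) eq = begin
      det (suc (suc (suc p))) B ≈⟨ sym (sign-cancel 1 (det-moveToFront (suc (suc p)) 1 B (s≤s z≤n))) ⟩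
      sign 1 * det (suc (suc (suc p))) (λ a b → B (moveToFront 1 a) b) ≈⟨ *-congˡ (det-equalRows-suc (suc p) 0 (suc i') (λ a b → B (moveToFront 1 a) b) (s≤s z≤n) i'≤p eq) ⟩
      sign 1 * 0# ≈⟨ zeroʳ _ ⟩
      0# ∎

    det-equalRows-suc : ∀ p i i' (B : Matrix) → i < i' → i' ≤ p → (∀ b → B (suc i) b ≈ B (suc i') b) → det (suc (suc p)) B ≈ 0#
    det-equalRows-suc p i i' B i<i' i'≤p eq = Σ-0 (suc (suc p)) (λ j _ →
      trans (*-congˡ (trans (*-congˡ (det-equalRows p i i' (λ a b → B (suc a) (punchIn j b)) i<i' i'≤p (λ b → eq (punchIn j b)))) (zeroʳ _))) (zeroʳ _))

  module RowPair (i i' : ℕ) (B : Matrix) where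
    withRows : (ℕ → Carrier) → (ℕ → Carrier) → Matrix
    withRows u v a b = if a ≡ᵇ i then u b else (if a ≡ᵇ i' then v b else B a b)

    withRows-i : ∀ u v b → withRows u v i b ≡ u b
    withRows-i u v b rewrite ≡ᵇ-refl i = ≡.refl

    withRows-i' : i < i' → ∀ u v b → withRows u v i' b ≡ v b
    withRows-i' lt u v b rewrite ≡ᵇ-false (λ e → ℕₚ.<⇒≢ lt (≡.sym e)) | ≡ᵇ-refl i' = ≡.refl

    withRows-≢i : ∀ u u' v a b → a ≢ i → withRows u v a b ≡ withRows u' v a b
    withRows-≢i u u' v a b ne rewrite ≡ᵇ-false ne = ≡.refl

    withRows-≢i' : ∀ u v v' a b → a ≢ i' → withRows u v a b ≡ withRows u v' a b
    withRows-≢i' u v v' a b ne with a ≡ᵇ i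
    ... | true = ≡.refl
    ... | false rewrite ≡ᵇ-false ne = ≡.refl

    withRows-self : ∀ a b → withRows (B i) (B i') a b ≡ B a b
    withRows-self a b with a ≡ᵇ i in e1
    ... | true = ≡.cong (λ z → B z b) (≡.sym (≡ᵇ-true⇒≡ a i e1))
    ... | false with a ≡ᵇ i' in e2
    ...   | true = ≡.cong (λ z → B z b) (≡.sym (≡ᵇ-true⇒≡ a i' e2))
    ...   | false = ≡.refl

    withRows-swapped : ∀ a b → withRows (B i') (B i) a b ≡ B (swapIdx i i' a) b
    withRows-swapped a b with a ≡ᵇ i
    ... | true = ≡.refl
    ... | false with a ≡ᵇ i'
    ...   | true = ≡.refl
    ...   | false = ≡.refl

  -- With D u v the determinant with rows i, i' replaced by u, v: 0 = D (x+y) (x+y) = D x y + D y x.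
  det-swapRows : ∀ p i i' (B : Matrix) → i < i' → i' ≤ p → det (suc p) (λ a b → B (swapIdx i i' a) b) ≈ - det (suc p) B
  det-swapRows p i i' B i<i' i'≤p = begin
    det (suc p) (λ a b → B (swapIdx i i' a) b) ≈⟨ det-cong′ (suc p) (λ a b → reflexive (≡.sym (withRows-swapped a b))) ⟩
    Dyx ≈⟨ sym (+-identityˡ _) ⟩
    0# + Dyx ≈⟨ +-congʳ (sym (-‿inverseʳ Dxy)) ⟩
    (Dxy + - Dxy) + Dyx ≈⟨ solve 3 (λ a b c → (a :+ b) :+ c := b :+ (a :+ c)) refl Dxy (- Dxy) Dyx ⟩
    - Dxy + (Dxy + Dyx) ≈⟨ +-congˡ Dxy+Dyx≈0# ⟩
    - Dxy + 0# ≈⟨ +-identityʳ _ ⟩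
    - Dxy ≈⟨ -‿cong (det-cong′ (suc p) (λ a b → reflexive (withRows-self a b))) ⟩
    - det (suc p) B ∎
    where
    open RowPair i i' B
    i≤p : i ≤ p
    i≤p = ℕₚ.≤-trans (ℕₚ.n≤1+n i) (ℕₚ.≤-trans i<i' i'≤p)
    x y : ℕ → Carrier
    x = B i
    y = B i'
    xy : ℕ → Carrier
    xy b = x b + y b
    D : (ℕ → Carrier) → (ℕ → Carrier) → Carrier
    D u v = det (suc p) (withRows u v)
    Dxy = D x y
    Dyx = D y x
    D-equal : ∀ u → D u u ≈ 0#
    D-equal u = det-equalRows p i i' (withRows u u) i<i' i'≤p (λ b → reflexive (≡.trans (withRows-i u u b) (≡.sym (withRows-i' i<i' u u b))))
    D-linearˡ : ∀ u₁ u₂ v → D (λ b → u₁ b + u₂ b) v ≈ D u₁ v + D u₂ v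
    D-linearˡ u₁ u₂ v = det-linear p i (withRows u₁₂ v) (withRows u₁ v) (withRows u₂ v) i≤p (λ a b ne → reflexive (withRows-≢i u₁₂ u₁ v a b ne)) (λ a b ne → reflexive (withRows-≢i u₁₂ u₂ v a b ne))
      (λ b → reflexive (≡.trans (withRows-i u₁₂ v b) (≡.cong₂ _+_ (≡.sym (withRows-i u₁ v b)) (≡.sym (withRows-i u₂ v b)))))
      where
      u₁₂ : ℕ → Carrier
      u₁₂ b = u₁ b + u₂ b
    D-linearʳ : ∀ u v₁ v₂ → D u (λ b → v₁ b + v₂ b) ≈ D u v₁ + D u v₂
    D-linearʳ u v₁ v₂ = det-linear p i' (withRows u v₁₂) (withRows u v₁) (withRows u v₂) i'≤p (λ a b ne → reflexive (withRows-≢i' u v₁₂ v₁ a b ne)) (λ a b ne → reflexive (withRows-≢i' u v₁₂ v₂ a b ne))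
      (λ b → reflexive (≡.trans (withRows-i' i<i' u v₁₂ b) (≡.cong₂ _+_ (≡.sym (withRows-i' i<i' u v₁ b)) (≡.sym (withRows-i' i<i' u v₂ b)))))
      where
      v₁₂ : ℕ → Carrier
      v₁₂ b = v₁ b + v₂ b
    Dxy+Dyx≈0# : Dxy + Dyx ≈ 0#
    Dxy+Dyx≈0# = begin
      Dxy + Dyx ≈⟨ sym (+-cong (+-identityˡ _) (+-identityʳ _)) ⟩
      (0# + Dxy) + (Dyx + 0#) ≈⟨ sym (+-cong (+-congʳ (D-equal x)) (+-congˡ (D-equal y))) ⟩
      (D x x + Dxy) + (Dyx + D y y) ≈⟨ sym (+-cong (D-linearʳ x x y) (D-linearʳ y x y)) ⟩
      D x xy + D y xy ≈⟨ sym (D-linearˡ x y xy) ⟩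
      D xy xy ≈⟨ D-equal xy ⟩
      0# ∎

  det-swapRows′ : ∀ p i i' (C : Matrix) → i ≢ i' → i < suc p → i' < suc p → det (suc p) (λ a b → C (swapIdx i i' a) b) ≈ - det (suc p) C
  det-swapRows′ p i i' C i≢i' i<sp i'<sp with ℕₚ.<-cmp i i'
  ... | tri< i<i' _ _ = det-swapRows p i i' C i<i' (ℕₚ.≤-pred i'<sp)
  ... | tri≈ _ i≡i' _ = ⊥-elim (i≢i' i≡i')
  ... | tri> _ _ i'<i = trans (det-cong′ (suc p) (λ a b → reflexive (≡.cong (λ z → C z b) (swapIdx-comm i i' i≢i' a))))
                              (det-swapRows p i' i C i'<i (ℕₚ.≤-pred i<sp))

  det-cols-from-rows : ∀ p (C : Matrix) (f g : ℕ → ℕ) (s : Carrier) →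
    (∀ (C' : Matrix) → det p (λ a b → C' (f a) b) ≈ s * det p (λ a b → C' (g a) b)) →
    det p (λ a b → C a (f b)) ≈ s * det p (λ a b → C a (g b))
  det-cols-from-rows p C f g s rows = begin
    det p (λ a b → C a (f b))     ≈⟨ sym (det-transpose p (λ a b → C a (f b))) ⟩
    det p (λ a b → C b (f a))     ≈⟨ rows (λ x b → C b x) ⟩
    s * det p (λ a b → C b (g a)) ≈⟨ *-congˡ (det-transpose p (λ a b → C a (g b))) ⟩
    s * det p (λ a b → C a (g b)) ∎

  det-unmoveToFront : ∀ p i (C : Matrix) → i ≤ p → det (suc p) C ≈ sign i * det (suc p) (λ a b → C (moveToFront i a) b)
  det-unmoveToFront p i C i≤p = sym (sign-cancel i (det-moveToFront p i C i≤p))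

  -- Rows listed as the increasing enumeration of {0, …, p} ∖ {a} followed by a row w, versus w put in place of a.
  det-lastRowToPlace : ∀ p (C : Matrix) a w (f : ℕ → ℕ) → a ≤ p → (∀ x → x < p → f x ≡ punchIn a x) → f p ≡ w →
    det (suc p) (λ i j → C (f i) j) ≈ sign (p +ℕ a) * det (suc p) (λ i j → C (update (λ x → x) a w i) j)
  det-lastRowToPlace p C a w f a≤p f-punchIn f-last = begin
    det (suc p) (λ i j → C (f i) j)                                     ≈⟨ det-unmoveToFront p p (λ i j → C (f i) j) ℕₚ.≤-refl ⟩
    sign p * det (suc p) (λ i j → C (f (moveToFront p i)) j)            ≈⟨ *-congˡ (det-cong (suc p) same-rows) ⟩
    sign p * det (suc p) (λ i j → C (u (moveToFront a i)) j)            ≈⟨ *-congˡ (det-moveToFront p a (λ i j → C (u i) j) a≤p) ⟩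
    sign p * (sign a * det (suc p) (λ i j → C (u i) j))                 ≈⟨ sym (*-assoc _ _ _) ⟩
    (sign p * sign a) * det (suc p) (λ i j → C (u i) j)                 ≈⟨ *-congʳ (sym (sign-+ p a)) ⟩
    sign (p +ℕ a) * det (suc p) (λ i j → C (u i) j) ∎
    where
    u : ℕ → ℕ
    u = update (λ x → x) a w
    same-rows : ∀ i j → i < suc p → j < suc p → C (f (moveToFront p i)) j ≈ C (u (moveToFront a i)) j
    same-rows zero    j _ _ = reflexive (≡.cong (λ z → C z j) (≡.trans f-last (≡.sym (update-same (λ x → x) a w))))
    same-rows (suc x) j (s≤s x<p) _ = reflexive (≡.cong (λ z → C z j)
      (≡.trans (≡.cong f (punchIn-< x<p)) (≡.trans (f-punchIn x x<p) (≡.sym (update-≢ (λ x → x) a w (punchIn a x) (punchInⱼ≢j a x))))))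

  -- Rows listed as a row w followed by the increasing enumeration of s + ({0, …, p} ∖ {a}), versus w put in place of s + a.
  det-firstRowToPlace : ∀ p (C : Matrix) s a w (f : ℕ → ℕ) → a ≤ p → f 0 ≡ w → (∀ x → x < p → f (suc x) ≡ s +ℕ punchIn a x) →
    det (suc p) (λ i j → C (f i) j) ≈ sign a * det (suc p) (λ i j → C (update (s +ℕ_) a w i) j)
  det-firstRowToPlace p C s a w f a≤p f-first f-punchIn = trans (det-cong (suc p) same-rows) (det-moveToFront p a (λ i j → C (u i) j) a≤p)
    where
    u : ℕ → ℕ
    u = update (s +ℕ_) a w
    same-rows : ∀ i j → i < suc p → j < suc p → C (f i) j ≈ C (u (moveToFront a i)) j
    same-rows zero    j _ _ = reflexive (≡.cong (λ z → C z j) (≡.trans f-first (≡.sym (update-same (s +ℕ_) a w))))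
    same-rows (suc x) j (s≤s x<p) _ = reflexive (≡.cong (λ z → C z j)
      (≡.trans (f-punchIn x x<p) (≡.sym (update-≢ (s +ℕ_) a w (punchIn a x) (punchInⱼ≢j a x)))))

  module TwoRowsToPlace (p : ℕ) (base : ℕ → ℕ) {a b : ℕ} (w₁ w₂ : ℕ) (a<b : a < b) (b≤p : b ≤ p) where

    u : ℕ → ℕ
    u = update (update base b w₂) a w₁

    moved : ℕ → ℕ
    moved i = u (moveToFront b (moveToFront (suc a) i))

    moved-0 : moved 0 ≡ w₁
    moved-0 = ≡.trans (≡.cong u (punchIn-< a<b)) (update-same (update base b w₂) a w₁)

    moved-1 : moved 1 ≡ w₂
    moved-1 = ≡.trans (update-≢ (update base b w₂) a w₁ b (ℕₚ.>⇒≢ a<b)) (update-same base b w₂)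

    moved-2+ : ∀ x → moved (suc (suc x)) ≡ base (punchIn b (punchIn a x))
    moved-2+ x = ≡.trans (update-≢ (update base b w₂) a w₁ (punchIn b (punchIn a x)) (punchInⱼ≢j a x ∘ punchIn≡-below a<b))
                         (update-≢ base b w₂ (punchIn b (punchIn a x)) (punchInⱼ≢j b (punchIn a x)))

    det-moved : ∀ (C : Matrix) → det (suc p) (λ i j → C (moved i) j) ≈ sign (suc (a +ℕ b)) * det (suc p) (λ i j → C (u i) j)
    det-moved C = begin
      det (suc p) (λ i j → C (moved i) j)                  ≈⟨ det-moveToFront p (suc a) (λ i j → C (u (moveToFront b i)) j) (ℕₚ.≤-trans a<b b≤p) ⟩
      sign (suc a) * det (suc p) (λ i j → C (u (moveToFront b i)) j) ≈⟨ *-congˡ (det-moveToFront p b (λ i j → C (u i) j) b≤p) ⟩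
      sign (suc a) * (sign b * det (suc p) (λ i j → C (u i) j))      ≈⟨ sym (*-assoc _ _ _) ⟩
      (sign (suc a) * sign b) * det (suc p) (λ i j → C (u i) j)      ≈⟨ *-congʳ (sym (sign-+ (suc a) b)) ⟩
      sign (suc (a +ℕ b)) * det (suc p) (λ i j → C (u i) j) ∎

  det-lastTwoRowsToPlace : ∀ p q (C : Matrix) {a b} w₁ w₂ (f : ℕ → ℕ) → p ≡ suc q → a < b → b ≤ p →
    (∀ x → x < q → f x ≡ punchIn b (punchIn a x)) → f q ≡ w₁ → f p ≡ w₂ →
    det (suc p) (λ i j → C (f i) j) ≈ sign (suc (a +ℕ b)) * det (suc p) (λ i j → C (update (update (λ x → x) b w₂) a w₁ i) j)
  det-lastTwoRowsToPlace p q C {a} {b} w₁ w₂ f p≡ a<b b≤p f-punchIn f-q f-p = begin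
    det (suc p) (λ i j → C (f i) j)
      ≈⟨ det-unmoveToFront p p (λ i j → C (f i) j) ℕₚ.≤-refl ⟩
    sign p * det (suc p) (λ i j → C (f (moveToFront p i)) j)
      ≈⟨ *-congˡ (det-unmoveToFront p p (λ i j → C (f (moveToFront p i)) j) ℕₚ.≤-refl) ⟩
    sign p * (sign p * det (suc p) (λ i j → C (f (moveToFront p (moveToFront p i))) j))
      ≈⟨ trans (sym (*-assoc _ _ _)) (trans (*-congʳ (sign-squared p)) (*-identityˡ _)) ⟩
    det (suc p) (λ i j → C (f (moveToFront p (moveToFront p i))) j)
      ≈⟨ det-cong (suc p) same-rows ⟩
    det (suc p) (λ i j → C (moved i) j)
      ≈⟨ det-moved C ⟩
    sign (suc (a +ℕ b)) * det (suc p) (λ i j → C (u i) j) ∎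
    where
    open TwoRowsToPlace p (λ x → x) w₁ w₂ a<b b≤p
    q<p : q < p
    q<p = ℕₚ.≤-reflexive (≡.sym p≡)
    same-rows : ∀ i j → i < suc p → j < suc p → C (f (moveToFront p (moveToFront p i))) j ≈ C (moved i) j
    same-rows zero j _ _ = reflexive (≡.cong (λ z → C z j)
      (≡.trans (≡.cong (f ∘ moveToFront p) p≡) (≡.trans (≡.cong f (punchIn-< q<p)) (≡.trans f-q (≡.sym moved-0)))))
    same-rows (suc zero) j _ _ = reflexive (≡.cong (λ z → C z j)
      (≡.trans (≡.cong (f ∘ moveToFront p) (punchIn-< (ℕₚ.≤-trans (s≤s z≤n) q<p))) (≡.trans f-p (≡.sym moved-1))))
    same-rows (suc (suc x)) j (s≤s 2+x≤p) _ = reflexive (≡.cong (λ z → C z j)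
      (≡.trans (≡.cong (f ∘ moveToFront p) (punchIn-< 2+x≤p))
        (≡.trans (≡.cong f (punchIn-< (ℕₚ.<-trans (ℕₚ.n<1+n x) 2+x≤p)))
          (≡.trans (f-punchIn x (ℕₚ.≤-pred (ℕₚ.≤-trans 2+x≤p (ℕₚ.≤-reflexive p≡)))) (≡.sym (moved-2+ x))))))

  det-firstTwoRowsToPlace : ∀ p (C : Matrix) s {a b} w₁ w₂ (f : ℕ → ℕ) → a < b → b ≤ p →
    f 0 ≡ w₁ → f 1 ≡ w₂ → (∀ x → suc (suc x) < suc p → f (suc (suc x)) ≡ s +ℕ punchIn b (punchIn a x)) →
    det (suc p) (λ i j → C (f i) j) ≈ sign (suc (a +ℕ b)) * det (suc p) (λ i j → C (update (update (s +ℕ_) b w₂) a w₁ i) j)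
  det-firstTwoRowsToPlace p C s w₁ w₂ f a<b b≤p f-0 f-1 f-2+ = trans (det-cong (suc p) same-rows) (det-moved C)
    where
    open TwoRowsToPlace p (s +ℕ_) w₁ w₂ a<b b≤p
    same-rows : ∀ i j → i < suc p → j < suc p → C (f i) j ≈ C (moved i) j
    same-rows zero          j _   _ = reflexive (≡.cong (λ z → C z j) (≡.trans f-0 (≡.sym moved-0)))
    same-rows (suc zero)    j _   _ = reflexive (≡.cong (λ z → C z j) (≡.trans f-1 (≡.sym moved-1)))
    same-rows (suc (suc x)) j i<p _ = reflexive (≡.cong (λ z → C z j) (≡.trans (f-2+ x i<p) (≡.sym (moved-2+ x))))

module Exchange {c ℓ : Level} (R : CommutativeRing c ℓ) (k₀ : ℕ) (B : ℕ → ℕ → CommutativeRing.Carrier R) where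

  open CommutativeRing R hiding (zero)
  open import Relation.Binary.Reasoning.Setoid setoid
  open import Algebra.Properties.Ring ring using (-‿+-comm; -‿involutive)
  open import Algebra.Solver.Ring.NaturalCoefficients.Default commutativeSemiring using (solve; _:+_; _:*_; _:=_)
  open Sums R
  open Determinants R

  k : ℕ
  k = suc k₀

  inS inT : ℕ → ℕ
  inS x = x
  inT x = k +ℕ x

  block : (ℕ → ℕ) → (ℕ → ℕ) → Matrix
  block u v p q = B (u p) (v q)

  -- exchS a a' indexes the first block with its a-th row (or column) replaced by the a'-th one of the second block.
  exchS : ℕ → ℕ → ℕ → ℕ
  exchS a a' = update inS a (k +ℕ a')

  exchT : ℕ → ℕ → ℕ → ℕ
  exchT a' a = update inT a' a

  det-block-rows : ∀ {u u' v} → (∀ z → u z ≡ u' z) → det k (block u v) ≈ det k (block u' v)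
  det-block-rows {v = v} u≗u' = det-cong′ k (λ p q → reflexive (≡.cong (λ z → B z (v q)) (u≗u' p)))

  module ColumnRowExchange (u v : ℕ → ℕ) where
    minorS : ℕ → ℕ → Carrier
    minorS i c = det k₀ (λ a b → B (u (punchIn i a)) (punchIn c b))
    minorT : ℕ → ℕ → Carrier
    minorT i' c' = det k₀ (λ a b → B (v (punchIn i' a)) (k +ℕ punchIn c' b))

    expand-colS : ∀ c c' → c < k → det k (block u (exchS c c')) ≈ Σ k (λ i → sign (i +ℕ c) * (B (u i) (k +ℕ c') * minorS i c))
    expand-colS c c' c<k = trans (det-expand-col k₀ c (block u (exchS c c')) (ℕₚ.≤-pred c<k))
      (Σ-cong′ k (λ i → *-congˡ (*-cong (reflexive (≡.cong (B (u i)) (update-same inS c (k +ℕ c'))))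
         (det-cong′ k₀ (λ a b → reflexive (≡.cong (B (u (punchIn i a))) (update-≢ inS c (k +ℕ c') (punchIn c b) (punchInⱼ≢j c b))))))))

    expand-colT : ∀ c c' → c' < k → det k (block v (exchT c' c)) ≈ Σ k (λ i' → sign (i' +ℕ c') * (B (v i') c * minorT i' c'))
    expand-colT c c' c'<k = trans (det-expand-col k₀ c' (block v (exchT c' c)) (ℕₚ.≤-pred c'<k))
      (Σ-cong′ k (λ i' → *-congˡ (*-cong (reflexive (≡.cong (B (v i')) (update-same inT c' c)))
         (det-cong′ k₀ (λ a b → reflexive (≡.cong (B (v (punchIn i' a))) (update-≢ inT c' c (punchIn c' b) (punchInⱼ≢j c' b))))))))

    expand-rowS : ∀ a b → a < k → det k (block (update u a (v b)) inS) ≈ Σ k (λ c → sign (a +ℕ c) * (B (v b) c * minorS a c))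
    expand-rowS a b a<k = trans (det-expand-row k₀ a (block (update u a (v b)) inS) (ℕₚ.≤-pred a<k))
      (Σ-cong′ k (λ c → *-congˡ (*-cong (reflexive (≡.cong (λ z → B z c) (update-same u a (v b))))
         (det-cong′ k₀ (λ x y → reflexive (≡.cong (λ z → B z (punchIn c y)) (update-≢ u a (v b) (punchIn a x) (punchInⱼ≢j a x))))))))

    expand-rowT : ∀ a b → b < k → det k (block (update v b (u a)) inT) ≈ Σ k (λ c' → sign (b +ℕ c') * (B (u a) (k +ℕ c') * minorT b c'))
    expand-rowT a b b<k = trans (det-expand-row k₀ b (block (update v b (u a)) inT) (ℕₚ.≤-pred b<k))
      (Σ-cong′ k (λ c' → *-congˡ (*-cong (reflexive (≡.cong (λ z → B z (k +ℕ c')) (update-same v b (u a))))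
         (det-cong′ k₀ (λ x y → reflexive (≡.cong (λ z → B z (k +ℕ punchIn c' y)) (update-≢ v b (u a) (punchIn b x) (punchInⱼ≢j b x))))))))

    term : ℕ → ℕ → ℕ → ℕ → Carrier
    term i i' c c' = (sign (i +ℕ c) * (B (u i) (k +ℕ c') * minorS i c)) * (sign (i' +ℕ c') * (B (v i') c * minorT i' c'))

    -- Expand both factors along the exchanged column; regrouping the entries B (u i) (k + c') and B (v i') c
    -- turns the result into the row expansions of the row-exchanged determinants.
    Σ-columnExchanges≈Σ-rowExchanges : Σ k (λ c → Σ k (λ c' → det k (block u (exchS c c')) * det k (block v (exchT c' c)))) ≈
           Σ k (λ a → Σ k (λ b → det k (block (update u a (v b)) inS) * det k (block (update v b (u a)) inT)))
    Σ-columnExchanges≈Σ-rowExchanges = begin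
      Σ k (λ c → Σ k (λ c' → det k (block u (exchS c c')) * det k (block v (exchT c' c))))
        ≈⟨ Σ-cong k (λ c c<k → Σ-cong k (λ c' c'<k → trans (*-cong (expand-colS c c' c<k) (expand-colT c c' c'<k)) (Σ-*-Σ k k _ _))) ⟩
      Σ k (λ c → Σ k (λ c' → Σ k (λ i → Σ k (λ i' → term i i' c c'))))
        ≈⟨ Σ²-Σ²-swap k term ⟩
      Σ k (λ i → Σ k (λ i' → Σ k (λ c → Σ k (λ c' → term i i' c c'))))
        ≈⟨ Σ-cong′ k (λ i → Σ-cong′ k (λ i' → Σ-cong′ k (λ c → Σ-cong′ k (λ c' → swap-entries i i' c c')))) ⟩
      Σ k (λ a → Σ k (λ b → Σ k (λ c → Σ k (λ c' → (sign (a +ℕ c) * (B (v b) c * minorS a c)) * (sign (b +ℕ c') * (B (u a) (k +ℕ c') * minorT b c'))))))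
        ≈⟨ Σ-cong k (λ a a<k → Σ-cong k (λ b b<k → sym (trans (*-cong (expand-rowS a b a<k) (expand-rowT a b b<k)) (Σ-*-Σ k k _ _)))) ⟩
      Σ k (λ a → Σ k (λ b → det k (block (update u a (v b)) inS) * det k (block (update v b (u a)) inT))) ∎
      where
      swap-entries : ∀ i i' c c' → term i i' c c' ≈ (sign (i +ℕ c) * (B (v i') c * minorS i c)) * (sign (i' +ℕ c') * (B (u i) (k +ℕ c') * minorT i' c'))
      swap-entries i i' c c' = solve 6 (λ s1 s2 x y m1 m2 → (s1 :* (x :* m1)) :* (s2 :* (y :* m2)) := (s1 :* (y :* m1)) :* (s2 :* (x :* m2))) refl
        (sign (i +ℕ c)) (sign (i' +ℕ c')) (B (u i) (k +ℕ c')) (B (v i') c) (minorS i c) (minorT i' c')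

  detPair : (ℕ → ℕ) → (ℕ → ℕ) → (ℕ → ℕ) → (ℕ → ℕ) → Carrier
  detPair u v x y = det k (block u x) * det k (block v y)

  D₀ : Carrier
  D₀ = detPair inS inT inS inT

  D₁ : ℕ → ℕ → Carrier
  D₁ a a' = detPair (exchS a a') (exchT a' a) inS inT

  exchS² : ℕ → ℕ → ℕ → ℕ → ℕ → ℕ
  exchS² a b a' b' = update (update inS b (k +ℕ b')) a (k +ℕ a')

  exchT² : ℕ → ℕ → ℕ → ℕ → ℕ → ℕ
  exchT² a' b' a b = update (update inT b' b) a' a

  D₂ : ℕ → ℕ → ℕ → ℕ → Carrier
  D₂ a b a' b' = detPair (exchS² a b a' b') (exchT² a' b' a b) inS inT

  -- The row-exchange summands of Σ-columnExchanges≈Σ-rowExchanges for u = exchS a a' and v = exchT a' a.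
  crossTerm : ℕ → ℕ → ℕ → ℕ → Carrier
  crossTerm a a' x y = det k (block (update (exchS a a') x (exchT a' a y)) inS) * det k (block (update (exchT a' a) y (exchS a a' x)) inT)

  module Reexchange (a a' : ℕ) where
    restore-S : ∀ z → update (exchS a a') a (exchT a' a a') z ≡ inS z
    restore-S z with z ≟ a
    ... | yes e = ≡.trans (update-≡ (exchS a a') a _ z e) (≡.trans (update-same inT a' a) (≡.sym e))
    ... | no ne = ≡.trans (update-≢ (exchS a a') a _ z ne) (update-≢ inS a _ z ne)

    restore-T : ∀ z → update (exchT a' a) a' (exchS a a' a) z ≡ inT z
    restore-T z with z ≟ a'
    ... | yes e = ≡.trans (update-≡ (exchT a' a) a' _ z e) (≡.trans (update-same inS a (k +ℕ a')) (≡.cong (k +ℕ_) (≡.sym e)))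
    ... | no ne = ≡.trans (update-≢ (exchT a' a) a' _ z ne) (update-≢ inT a' _ z ne)

    reexchange-S-at-a : ∀ y → y ≢ a' → ∀ z → update (exchS a a') a (exchT a' a y) z ≡ exchS a y z
    reexchange-S-at-a y ny z with z ≟ a
    ... | yes e = ≡.trans (update-≡ (exchS a a') a _ z e) (≡.trans (update-≢ inT a' a y ny) (≡.sym (update-≡ inS a _ z e)))
    ... | no ne = ≡.trans (update-≢ (exchS a a') a _ z ne) (≡.trans (update-≢ inS a _ z ne) (≡.sym (update-≢ inS a _ z ne)))

    reexchange-T-at-a : ∀ y → y ≢ a' → ∀ z → update (exchT a' a) y (exchS a a' a) z ≡ exchT y a (swapIdx a' y z)
    reexchange-T-at-a y ny z with z ≟ y | z ≟ a'
    ... | yes e1 | yes e2 = ⊥-elim (ny (≡.trans (≡.sym e1) e2))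
    ... | yes e1 | no n2 = ≡.trans (update-≡ (exchT a' a) y _ z e1) (≡.trans (update-same inS a (k +ℕ a'))
          (≡.sym (≡.trans (≡.cong (exchT y a) (swapIdx-ʳ a' y z n2 e1)) (update-≢ inT y a a' (λ e → ny (≡.sym e))))))
    ... | no n1 | yes e2 = ≡.trans (update-≢ (exchT a' a) y _ z n1) (≡.trans (update-≡ inT a' a z e2)
          (≡.sym (≡.trans (≡.cong (exchT y a) (swapIdx-ˡ a' y z e2)) (update-same inT y a))))
    ... | no n1 | no n2 = ≡.trans (update-≢ (exchT a' a) y _ z n1) (≡.trans (update-≢ inT a' a z n2)
          (≡.sym (≡.trans (≡.cong (exchT y a) (swapIdx-≢ a' y z n2 n1)) (update-≢ inT y a z n1))))

    reexchange-S-at-a′ : ∀ x → x ≢ a → ∀ z → update (exchS a a') x (exchT a' a a') z ≡ exchS x a' (swapIdx a x z)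
    reexchange-S-at-a′ x nx z with z ≟ x | z ≟ a
    ... | yes e1 | yes e2 = ⊥-elim (nx (≡.trans (≡.sym e1) e2))
    ... | yes e1 | no n2 = ≡.trans (update-≡ (exchS a a') x _ z e1) (≡.trans (update-same inT a' a)
          (≡.sym (≡.trans (≡.cong (exchS x a') (swapIdx-ʳ a x z n2 e1)) (update-≢ inS x _ a (λ e → nx (≡.sym e))))))
    ... | no n1 | yes e2 = ≡.trans (update-≢ (exchS a a') x _ z n1) (≡.trans (update-≡ inS a _ z e2)
          (≡.sym (≡.trans (≡.cong (exchS x a') (swapIdx-ˡ a x z e2)) (update-same inS x _))))
    ... | no n1 | no n2 = ≡.trans (update-≢ (exchS a a') x _ z n1) (≡.trans (update-≢ inS a _ z n2)
          (≡.sym (≡.trans (≡.cong (exchS x a') (swapIdx-≢ a x z n2 n1)) (update-≢ inS x _ z n1))))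

    reexchange-T-at-a′ : ∀ x → x ≢ a → ∀ z → update (exchT a' a) a' (exchS a a' x) z ≡ exchT a' x z
    reexchange-T-at-a′ x nx z with z ≟ a'
    ... | yes e = ≡.trans (update-≡ (exchT a' a) a' _ z e) (≡.trans (update-≢ inS a _ x nx) (≡.sym (update-≡ inT a' x z e)))
    ... | no ne = ≡.trans (update-≢ (exchT a' a) a' _ z ne) (≡.trans (update-≢ inT a' a z ne) (≡.sym (update-≢ inT a' x z ne)))

    reexchange-S : ∀ x y → x ≢ a → y ≢ a' → ∀ z → update (exchS a a') x (exchT a' a y) z ≡ exchS² a x a' y z
    reexchange-S x y nx ny z with z ≟ x | z ≟ a
    ... | yes e1 | yes e2 = ⊥-elim (nx (≡.trans (≡.sym e1) e2))
    ... | yes e1 | no n2 = ≡.trans (update-≡ (exchS a a') x _ z e1) (≡.trans (update-≢ inT a' a y ny)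
          (≡.sym (≡.trans (update-≢ (update inS x (k +ℕ y)) a _ z n2) (update-≡ inS x _ z e1))))
    ... | no n1 | yes e2 = ≡.trans (update-≢ (exchS a a') x _ z n1) (≡.trans (update-≡ inS a _ z e2)
          (≡.sym (update-≡ (update inS x (k +ℕ y)) a _ z e2)))
    ... | no n1 | no n2 = ≡.trans (update-≢ (exchS a a') x _ z n1) (≡.trans (update-≢ inS a _ z n2)
          (≡.sym (≡.trans (update-≢ (update inS x (k +ℕ y)) a _ z n2) (update-≢ inS x _ z n1))))

    reexchange-T : ∀ x y → x ≢ a → y ≢ a' → ∀ z → update (exchT a' a) y (exchS a a' x) z ≡ exchT² a' y a x z
    reexchange-T x y nx ny z with z ≟ y | z ≟ a'
    ... | yes e1 | yes e2 = ⊥-elim (ny (≡.trans (≡.sym e1) e2))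
    ... | yes e1 | no n2 = ≡.trans (update-≡ (exchT a' a) y _ z e1) (≡.trans (update-≢ inS a _ x nx)
          (≡.sym (≡.trans (update-≢ (update inT y x) a' _ z n2) (update-≡ inT y _ z e1))))
    ... | no n1 | yes e2 = ≡.trans (update-≢ (exchT a' a) y _ z n1) (≡.trans (update-≡ inT a' _ z e2)
          (≡.sym (update-≡ (update inT y x) a' _ z e2)))
    ... | no n1 | no n2 = ≡.trans (update-≢ (exchT a' a) y _ z n1) (≡.trans (update-≢ inT a' _ z n2)
          (≡.sym (≡.trans (update-≢ (update inT y x) a' _ z n2) (update-≢ inT y _ z n1))))

  module CrossTermValues (a a' : ℕ) (a<k : a < k) (a'<k : a' < k) where
    open Reexchange a a'

    crossTerm-a-a′ : crossTerm a a' a a' ≈ D₀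
    crossTerm-a-a′ = *-cong (det-block-rows restore-S)
                 (det-block-rows restore-T)

    crossTerm-a-y : ∀ y → y ≢ a' → y < k → crossTerm a a' a y ≈ - D₁ a y
    crossTerm-a-y y ny y<k = trans (*-cong (det-block-rows (reexchange-S-at-a y ny))
        (trans (det-block-rows (reexchange-T-at-a y ny))
               (det-swapRows′ k₀ a' y (block (exchT y a) inT) (λ e → ny (≡.sym e)) a'<k y<k)))
      (x*-y≈-xy _ _)

    crossTerm-x-a′ : ∀ x → x ≢ a → x < k → crossTerm a a' x a' ≈ - D₁ x a'
    crossTerm-x-a′ x nx x<k = trans (*-cong
        (trans (det-block-rows (reexchange-S-at-a′ x nx))
               (det-swapRows′ k₀ a x (block (exchS x a') inS) (λ e → nx (≡.sym e)) a<k x<k))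
        (det-block-rows (reexchange-T-at-a′ x nx)))
      (-x*y≈-xy _ _)

    crossTerm-x-y : ∀ x y → x ≢ a → y ≢ a' → crossTerm a a' x y ≈ D₂ a x a' y
    crossTerm-x-y x y nx ny = *-cong (det-block-rows (reexchange-S x y nx ny))
                           (det-block-rows (reexchange-T x y nx ny))

    Σ-crossTerm : Σ k (λ x → Σ k (λ y → crossTerm a a' x y)) ≈
      D₀ + (Σ k₀ (λ y → - D₁ a (punchIn a' y)) + (Σ k₀ (λ x → - D₁ (punchIn a x) a') + Σ k₀ (λ x → Σ k₀ (λ y → D₂ a (punchIn a x) a' (punchIn a' y)))))
    Σ-crossTerm = begin
      Σ k (λ x → Σ k (λ y → crossTerm a a' x y))
        ≈⟨ Σ-punchIn k₀ a (λ x → Σ k (λ y → crossTerm a a' x y)) (ℕₚ.≤-pred a<k) ⟩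
      Σ k (λ y → crossTerm a a' a y) + Σ k₀ (λ x → Σ k (λ y → crossTerm a a' (punchIn a x) y))
        ≈⟨ +-cong (Σ-punchIn k₀ a' (λ y → crossTerm a a' a y) (ℕₚ.≤-pred a'<k))
                  (Σ-cong′ k₀ (λ x → Σ-punchIn k₀ a' (λ y → crossTerm a a' (punchIn a x) y) (ℕₚ.≤-pred a'<k))) ⟩
      (crossTerm a a' a a' + Σ k₀ (λ y → crossTerm a a' a (punchIn a' y))) + Σ k₀ (λ x → crossTerm a a' (punchIn a x) a' + Σ k₀ (λ y → crossTerm a a' (punchIn a x) (punchIn a' y)))
        ≈⟨ +-cong (+-cong crossTerm-a-a′ (Σ-cong k₀ (λ y y<k₀ → crossTerm-a-y (punchIn a' y) (punchInⱼ≢j a' y) (punchIn-<-suc a' y<k₀))))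
                  (trans (Σ-+ k₀ (λ x → crossTerm a a' (punchIn a x) a') (λ x → Σ k₀ (λ y → crossTerm a a' (punchIn a x) (punchIn a' y))))
                    (+-cong (Σ-cong k₀ (λ x x<k₀ → crossTerm-x-a′ (punchIn a x) (punchInⱼ≢j a x) (punchIn-<-suc a x<k₀)))
                            (Σ-cong′ k₀ (λ x → Σ-cong′ k₀ (λ y → crossTerm-x-y (punchIn a x) (punchIn a' y) (punchInⱼ≢j a x) (punchInⱼ≢j a' y)))))) ⟩
      (D₀ + Σ k₀ (λ y → - D₁ a (punchIn a' y))) + (Σ k₀ (λ x → - D₁ (punchIn a x) a') + Σ k₀ (λ x → Σ k₀ (λ y → D₂ a (punchIn a x) a' (punchIn a' y))))
        ≈⟨ +-assoc _ _ _ ⟩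
      D₀ + (Σ k₀ (λ y → - D₁ a (punchIn a' y)) + (Σ k₀ (λ x → - D₁ (punchIn a x) a') + Σ k₀ (λ x → Σ k₀ (λ y → D₂ a (punchIn a x) a' (punchIn a' y))))) ∎

  D₂-flip : ∀ a b a' b' → a ≢ b → a' ≢ b' → D₂ a b a' b' ≈ D₂ b a b' a'
  D₂-flip a b a' b' n n' = *-cong (det-block-rows (update-comm inS a b (k +ℕ a') (k +ℕ b') n))
                              (det-block-rows (update-comm inT a' b' a b n'))

  D₂-swapT : ∀ a b a' b' → a ≢ b → a' ≢ b' → a < k → b < k → a' < k → b' < k → D₂ a b b' a' ≈ D₂ a b a' b'
  D₂-swapT a b a' b' n n' a<k b<k a'<k b'<k = trans (*-cong
    (trans (det-block-rows (update²-swapIdx inS a b (k +ℕ a') (k +ℕ b') n))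
           (det-swapRows′ k₀ a b (block (exchS² a b a' b') inS) n a<k b<k))
    (trans (det-cong′ k (λ p q → reflexive (≡.cong (λ z → B z (k +ℕ q))
              (≡.trans (update²-swapIdx inT b' a' b a (λ e → n' (≡.sym e)) p) (update-comm inT b' a' b a (λ e → n' (≡.sym e)) (swapIdx b' a' p))))))
           (det-swapRows′ k₀ b' a' (block (exchT² a' b' a b) inT) (λ e → n' (≡.sym e)) b'<k a'<k)))
    (-x*-y≈xy _ _)

  t₁ t₂ t₃ : Carrier
  t₁ = Σ k (λ a → Σ k (λ a' → Σ k (λ c → Σ k (λ c' → detPair (exchS a a') (exchT a' a) (exchS c c') (exchT c' c)))))
  t₂ = Σ k (λ a → Σ k (λ a' → D₁ a a'))
  t₃ = Σ k (λ a → Σ k (λ b → Σ k (λ a' → Σ k (λ b' → if a <ᵇ b then (if a' <ᵇ b' then D₂ a b a' b' else 0#) else 0#))))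

  Σ-D₀ : Σ k (λ a → Σ k (λ a' → D₀)) ≈ fromℕ k * (fromℕ k * D₀)
  Σ-D₀ = trans (Σ-cong′ k (λ a → Σ-const k D₀)) (Σ-const k _)

  Σ-D₁-otherT : Σ k (λ a → Σ k (λ a' → Σ k₀ (λ y → - D₁ a (punchIn a' y)))) ≈ - (fromℕ k₀ * t₂)
  Σ-D₁-otherT = begin
    Σ k (λ a → Σ k (λ a' → Σ k₀ (λ y → - D₁ a (punchIn a' y))))
      ≈⟨ Σ-cong′ k (λ a → trans (Σ-cong′ k (λ a' → sym (Σ-neg k₀ _))) (sym (Σ-neg k _))) ⟩
    Σ k (λ a → - Σ k (λ a' → Σ k₀ (λ y → D₁ a (punchIn a' y))))
      ≈⟨ Σ-cong′ k (λ a → -‿cong (Σ-Σ-punchIn k₀ (D₁ a))) ⟩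
    Σ k (λ a → - (fromℕ k₀ * Σ k (D₁ a)))
      ≈⟨ sym (Σ-neg k _) ⟩
    - Σ k (λ a → fromℕ k₀ * Σ k (D₁ a))
      ≈⟨ -‿cong (sym (Σ-*ˡ k (fromℕ k₀) _)) ⟩
    - (fromℕ k₀ * t₂) ∎

  Σ-D₁-otherS : Σ k (λ a → Σ k (λ a' → Σ k₀ (λ x → - D₁ (punchIn a x) a'))) ≈ - (fromℕ k₀ * t₂)
  Σ-D₁-otherS = begin
    Σ k (λ a → Σ k (λ a' → Σ k₀ (λ x → - D₁ (punchIn a x) a')))
      ≈⟨ Σ-cong′ k (λ a → Σ-swap k k₀ (λ a' x → - D₁ (punchIn a x) a')) ⟩
    Σ k (λ a → Σ k₀ (λ x → Σ k (λ a' → - D₁ (punchIn a x) a')))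
      ≈⟨ Σ-cong′ k (λ a → trans (Σ-cong′ k₀ (λ x → sym (Σ-neg k _))) (sym (Σ-neg k₀ _))) ⟩
    Σ k (λ a → - Σ k₀ (λ x → Σ k (λ a' → D₁ (punchIn a x) a')))
      ≈⟨ sym (Σ-neg k _) ⟩
    - Σ k (λ a → Σ k₀ (λ x → Σ k (λ a' → D₁ (punchIn a x) a')))
      ≈⟨ -‿cong (Σ-Σ-punchIn k₀ (λ x → Σ k (D₁ x))) ⟩
    - (fromℕ k₀ * t₂) ∎

  -- Each unordered pair of row exchanges occurs four times: D₂ is symmetric under swapping both pairs and,
  -- up to the sign that cancels between the two determinants, under swapping one of them.
  Σ-D₂-distinct : Σ k (λ a → Σ k₀ (λ x → Σ k (λ a' → Σ k₀ (λ y → D₂ a (punchIn a x) a' (punchIn a' y))))) ≈ fromℕ 4 * t₃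
  Σ-D₂-distinct = trans (Σ-offDiagonal-symmetric k₀ (fromℕ 4) overT orderedT four-times)
    (*-congˡ (Σ-cong′ k (λ a → Σ-cong′ k (λ b → sym (trans (Σ-cong′ k (λ a' → Σ-if k (a <ᵇ b) _)) (Σ-if k (a <ᵇ b) _))))))
    where
    overT orderedT : ℕ → ℕ → Carrier
    overT a b = Σ k (λ a' → Σ k₀ (λ y → D₂ a b a' (punchIn a' y)))
    orderedT a b = Σ k (λ a' → Σ k (λ b' → if a' <ᵇ b' then D₂ a b a' b' else 0#))
    four-times : ∀ a b → a < b → b < k → overT a b + overT b a ≈ fromℕ 4 * orderedT a b
    four-times a b a<b b<k = begin
      overT a b + overT b a
        ≈⟨ +-cong (Σ-offDiagonal-symmetric k₀ (fromℕ 2) (D₂ a b) (D₂ a b) twice)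
                  (Σ-offDiagonal-symmetric k₀ (fromℕ 2) (D₂ b a) (D₂ a b) twice-flipped) ⟩
      fromℕ 2 * orderedT a b + fromℕ 2 * orderedT a b ≈⟨ sym (distribʳ _ _ _) ⟩
      (fromℕ 2 + fromℕ 2) * orderedT a b              ≈⟨ *-congʳ (sym (fromℕ-+ 2 2)) ⟩
      fromℕ 4 * orderedT a b ∎
      where
      a≢b = ℕₚ.<⇒≢ a<b
      a<k = ℕₚ.<-trans a<b b<k
      swapT : ∀ {a' b'} → a' < b' → b' < k → D₂ a b b' a' ≈ D₂ a b a' b'
      swapT a'<b' b'<k = D₂-swapT a b _ _ a≢b (ℕₚ.<⇒≢ a'<b') a<k b<k (ℕₚ.<-trans a'<b' b'<k) b'<k
      twice : ∀ a' b' → a' < b' → b' < k → D₂ a b a' b' + D₂ a b b' a' ≈ fromℕ 2 * D₂ a b a' b'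
      twice a' b' a'<b' b'<k = trans (+-congˡ (swapT a'<b' b'<k)) (x+x≈2x _)
      twice-flipped : ∀ a' b' → a' < b' → b' < k → D₂ b a a' b' + D₂ b a b' a' ≈ fromℕ 2 * D₂ a b a' b'
      twice-flipped a' b' a'<b' b'<k = trans
        (+-cong (trans (D₂-flip b a a' b' (a≢b ∘ ≡.sym) (ℕₚ.<⇒≢ a'<b')) (swapT a'<b' b'<k))
                (D₂-flip b a b' a' (a≢b ∘ ≡.sym) (ℕₚ.>⇒≢ a'<b')))
        (x+x≈2x _)

  t₁-expansion : t₁ ≈ fromℕ k * (fromℕ k * D₀) + (- (fromℕ k₀ * t₂) + (- (fromℕ k₀ * t₂) + fromℕ 4 * t₃))
  t₁-expansion = begin
    t₁ ≈⟨ Σ-cong′ k (λ a → Σ-cong′ k (λ a' → ColumnRowExchange.Σ-columnExchanges≈Σ-rowExchanges (exchS a a') (exchT a' a))) ⟩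
    Σ k (λ a → Σ k (λ a' → Σ k (λ x → Σ k (λ y → crossTerm a a' x y))))
      ≈⟨ Σ-cong k (λ a a<k → Σ-cong k (λ a' a'<k → CrossTermValues.Σ-crossTerm a a' a<k a'<k)) ⟩
    Σ k (λ a → Σ k (λ a' → D₀ + (S₁ a a' + (S₂ a a' + S₃ a a'))))
      ≈⟨ trans (Σ²-+ k k _ _) (+-congˡ (trans (Σ²-+ k k _ _) (+-congˡ (Σ²-+ k k _ _)))) ⟩
    Σ k (λ a → Σ k (λ a' → D₀)) + (Σ k (λ a → Σ k (S₁ a)) + (Σ k (λ a → Σ k (S₂ a)) + Σ k (λ a → Σ k (S₃ a))))
      ≈⟨ +-cong Σ-D₀ (+-cong Σ-D₁-otherT (+-cong Σ-D₁-otherS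
           (trans (Σ-cong′ k (λ a → Σ-swap k k₀ (λ a' x → S₃-term a x a'))) Σ-D₂-distinct))) ⟩
    fromℕ k * (fromℕ k * D₀) + (- (fromℕ k₀ * t₂) + (- (fromℕ k₀ * t₂) + fromℕ 4 * t₃)) ∎
    where
    S₃-term : ℕ → ℕ → ℕ → Carrier
    S₃-term a x a' = Σ k₀ (λ y → D₂ a (punchIn a x) a' (punchIn a' y))
    S₁ S₂ S₃ : ℕ → ℕ → Carrier
    S₁ a a' = Σ k₀ (λ y → - D₁ a (punchIn a' y))
    S₂ a a' = Σ k₀ (λ x → - D₁ (punchIn a x) a')
    S₃ a a' = Σ k₀ (λ x → S₃-term a x a')

  blockIdentity : t₁ - fromℕ (2 *ℕ k₀) * (- t₂) - fromℕ 4 * t₃ - fromℕ (k *ℕ k) * D₀ ≈ 0#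
  blockIdentity = begin
    t₁ - fromℕ (2 *ℕ k₀) * (- t₂) - fromℕ 4 * t₃ - fromℕ (k *ℕ k) * D₀
      ≈⟨ +-cong (+-cong (+-congʳ t₁-expansion) refl) (-‿cong (trans (*-congʳ (fromℕ-* k k)) (*-assoc _ _ _))) ⟩
    (w + (- u + (- u + v))) - fromℕ (2 *ℕ k₀) * (- t₂) - v - w
      ≈⟨ +-congʳ (+-congʳ (+-congˡ (-‿cong two-u))) ⟩
    (w + (- u + (- u + v))) - (- u + - u) - v - w
      ≈⟨ +-congʳ (+-congʳ (+-congˡ (trans (sym (-‿+-comm (- u) (- u))) (+-cong (-‿involutive u) (-‿involutive u))))) ⟩
    (w + (- u + (- u + v))) + (u + u) - v - w
      ≈⟨ solve 6 (λ w u v nw nu nv → ((w :+ (nu :+ (nu :+ v))) :+ (u :+ u)) :+ nv :+ nw := (w :+ nw) :+ ((u :+ nu) :+ ((u :+ nu) :+ (v :+ nv))))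
           refl w u v (- w) (- u) (- v) ⟩
    (w - w) + ((u - u) + ((u - u) + (v - v)))
      ≈⟨ +-cong (-‿inverseʳ w) (+-cong (-‿inverseʳ u) (+-cong (-‿inverseʳ u) (-‿inverseʳ v))) ⟩
    0# + (0# + (0# + 0#))
      ≈⟨ trans (+-identityˡ _) (trans (+-identityˡ _) (+-identityˡ _)) ⟩
    0# ∎
    where
    w u v : Carrier
    w = fromℕ k * (fromℕ k * D₀)
    u = fromℕ k₀ * t₂
    v = fromℕ 4 * t₃
    two-u : fromℕ (2 *ℕ k₀) * (- t₂) ≈ - u + - u
    two-u = begin
      fromℕ (2 *ℕ k₀) * (- t₂)          ≈⟨ *-congʳ (trans (fromℕ-* 2 k₀) (sym (x+x≈2x (fromℕ k₀)))) ⟩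
      (fromℕ k₀ + fromℕ k₀) * (- t₂)    ≈⟨ distribʳ _ _ _ ⟩
      fromℕ k₀ * (- t₂) + fromℕ k₀ * (- t₂) ≈⟨ +-cong (x*-y≈-xy _ _) (x*-y≈-xy _ _) ⟩
      - u + - u ∎

-- toFin is only ever applied below the bound; out of range it returns 0.
toFin : ∀ {p} → ℕ → Fin (suc p)
toFin {p} x with x <? suc p
... | yes x<p = fromℕ< x<p
... | no  _   = fzero

toFin-toℕ : ∀ {p} (i : Fin (suc p)) → toFin (toℕ i) ≡ i
toFin-toℕ {p} i with toℕ i <? suc p
... | yes i<p = Finₚ.fromℕ<-toℕ i i<p
... | no  i≮p = ⊥-elim (i≮p (Finₚ.toℕ<n i))

toℕ-toFin : ∀ {p x} → x < suc p → toℕ (toFin {p} x) ≡ x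
toℕ-toFin {p} {x} x<p with x <? suc p
... | yes x<p′ = Finₚ.toℕ-fromℕ< x<p′
... | no  x≮p  = ⊥-elim (x≮p x<p)

cong₄ : ∀ {B : Set} (f : ℕ → ℕ → ℕ → ℕ → B) {x y z w x' y' z' w'} →
  x ≡ x' → y ≡ y' → z ≡ z' → w ≡ w' → f x y z w ≡ f x' y' z' w'
cong₄ f ≡.refl ≡.refl ≡.refl ≡.refl = ≡.refl

map-toℕ-elems : ∀ {p} size (X : Sub (suc p)) (Q : ℕ → Bool) → suc p ≡ size → (∀ i → X i ≡ Q (toℕ i)) →
  map toℕ (elems X) ≡ filterᵇ Q (upTo size)
map-toℕ-elems {p} size X Q p≡ X≡Q = ≡.trans (map-toℕ-filterᵇ X Q (allFin (suc p)) X≡Q)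
  (≡.cong (filterᵇ Q) (≡.trans (map-toℕ-allFin (suc p)) (≡.cong upTo p≡)))

rank-from-elems : ∀ {p} (L : Sub p) (i : Fin p) {s e l} → map toℕ (elems L) ≡ applyUpTo (s +ℕ_) l → toℕ i ≡ s +ℕ e → e ≤ l →
  rank L i ≡ e
rank-from-elems L i {s} {e} {l} elems-L i≡ e≤l = begin
  length (filterᵇ (λ j → toℕ j <ᵇ toℕ i) (elems L))
    ≡⟨ ≡.sym (Listₚ.length-map toℕ (filterᵇ (λ j → toℕ j <ᵇ toℕ i) (elems L))) ⟩
  length (map toℕ (filterᵇ (λ j → toℕ j <ᵇ toℕ i) (elems L)))
    ≡⟨ ≡.cong length (map-toℕ-filterᵇ (λ j → toℕ j <ᵇ toℕ i) (_<ᵇ toℕ i) (elems L) (λ _ → ≡.refl)) ⟩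
  length (filterᵇ (_<ᵇ toℕ i) (map toℕ (elems L)))
    ≡⟨ ≡.cong₂ (λ t l → length (filterᵇ (_<ᵇ t) l)) i≡ elems-L ⟩
  length (filterᵇ (_<ᵇ s +ℕ e) (applyUpTo (s +ℕ_) l))
    ≡⟨ length-filterᵇ-<ᵇ-applyUpTo s e l e≤l ⟩
  e ∎
  where open ≡.≡-Reasoning

length-punched-last : ∀ (g : ℕ → ℕ) p w → length (applyUpTo g p ++ w ∷ []) ≡ suc p
length-punched-last g p w = ≡.trans (Listₚ.length-++ (applyUpTo g p)) (≡.trans (≡.cong (_+ℕ 1) (Listₚ.length-applyUpTo g p)) (ℕₚ.+-comm p 1))

nth-punched-last : ∀ (g : ℕ → ℕ) p w → nth (applyUpTo g p ++ w ∷ []) p ≡ w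
nth-punched-last g p w = ≡.trans (≡.cong (nth (applyUpTo g p ++ w ∷ [])) (≡.sym (ℕₚ.+-identityʳ p))) (nth-applyUpTo-++ʳ g p (w ∷ []) 0)

module Minors {c ℓ : Level} (R : CommutativeRing c ℓ) (k₀ : ℕ) {m' n' rm rn : ℕ}
  (m≡ : suc m' ≡ suc k₀ +ℕ (suc k₀ +ℕ rm)) (n≡ : suc n' ≡ suc k₀ +ℕ (suc k₀ +ℕ rn))
  (A : Fin (suc m') → Fin (suc n') → CommutativeRing.Carrier R) where

  open CommutativeRing R hiding (zero)
  open import Relation.Binary.Reasoning.Setoid setoid
  open Sums R
  open Determinants R

  k : ℕ
  k = suc k₀

  B : Matrix
  B x y = A (toFin x) (toFin y)

  open Exchange R k₀ B using (inS; inT; block; exchS; exchT; exchS²; exchT²; detPair; D₀; D₁; D₂; t₁; t₂; t₃; blockIdentity)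

  sumL-tabulate : ∀ {q} {X : Set} (g : Fin q → X) (h : X → Carrier) (φ : ℕ → Carrier) → (∀ j → h (g j) ≈ φ (toℕ j)) →
    sumL R (tabulate g) h ≈ Σ q φ
  sumL-tabulate {zero}  g h φ e = sym (Σ-zero φ)
  sumL-tabulate {suc q} g h φ e =
    trans (+-cong (e fzero) (sumL-tabulate (g ∘ fsuc) h (φ ∘ suc) (e ∘ fsuc))) (sym (Σ-suc q φ))

  sumL≈Σ : ∀ {p} (xs : List (Fin (suc p))) (f : Fin (suc p) → Carrier) (g : ℕ → ℕ) q →
    map toℕ xs ≡ applyUpTo g q → sumL R xs f ≈ Σ q (λ a → f (toFin (g a)))
  sumL≈Σ []       f g zero    e = sym (Σ-zero _)
  sumL≈Σ (x ∷ xs) f g (suc q) e = trans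
    (+-cong (reflexive (≡.cong f (≡.trans (≡.sym (toFin-toℕ x)) (≡.cong toFin (Listₚ.∷-injectiveˡ e)))))
            (sumL≈Σ xs f (g ∘ suc) q (Listₚ.∷-injectiveʳ e)))
    (sym (Σ-suc q _))

  detL≈det : ∀ rs cs → length rs ≡ length cs → detL R A rs cs ≈ det (length rs) (λ x y → B (nth (map toℕ rs) x) (nth (map toℕ cs) y))
  detL≈det []       []  _ = refl
  detL≈det (r ∷ rs) cs  e = begin
    sumL R (allFin (length cs)) (λ j → sgn R (toℕ j) * (A r (lookup cs j) * detL R A rs (removeAt cs j)))
      ≈⟨ sumL-tabulate (λ j → j) _ φ expansion-term ⟩
    Σ (length cs) φ       ≈⟨ reflexive (≡.cong (λ q → Σ q φ) (≡.sym e)) ⟩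
    Σ (suc (length rs)) φ ∎
    where
    C : List ℕ
    C = map toℕ cs
    φ : ℕ → Carrier
    φ j = sign j * (B (toℕ r) (nth C j) * det (length rs) (λ a b → B (nth (map toℕ rs) a) (nth C (punchIn j b))))
    expansion-term : ∀ j → sgn R (toℕ j) * (A r (lookup cs j) * detL R A rs (removeAt cs j)) ≈ φ (toℕ j)
    expansion-term j = *-congˡ (*-cong
      (reflexive (≡.cong₂ A (≡.sym (toFin-toℕ r)) (≡.sym (≡.trans (≡.cong toFin (nth-map-toℕ-lookup cs j)) (toFin-toℕ (lookup cs j))))))
      (trans (detL≈det rs (removeAt cs j) (≡.trans (≡.cong pred e) (≡.sym (Listₚ.length-removeAt cs j))))
             (det-cong′ (length rs) (λ a b → reflexive (≡.cong (B (nth (map toℕ rs) a)) (nth-map-toℕ-removeAt cs j b))))))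

  minor≈det : ∀ (X : Sub (suc m')) (Y : Sub (suc n')) {LX LY : List ℕ} → map toℕ (elems X) ≡ LX → map toℕ (elems Y) ≡ LY →
    length LX ≡ k → length LY ≡ k → minor R A X Y ≈ det k (λ p q → B (nth LX p) (nth LY q))
  minor≈det X Y ≡.refl ≡.refl |X| |Y| = begin
    detL R A (elems X) (elems Y)
      ≈⟨ detL≈det (elems X) (elems Y) (≡.trans |elemsX| (≡.sym |elemsY|)) ⟩
    det (length (elems X)) (λ x y → B (nth (map toℕ (elems X)) x) (nth (map toℕ (elems Y)) y))
      ≈⟨ reflexive (≡.cong (λ s → det s (λ x y → B (nth (map toℕ (elems X)) x) (nth (map toℕ (elems Y)) y))) |elemsX|) ⟩
    det k (λ p q → B (nth (map toℕ (elems X)) p) (nth (map toℕ (elems Y)) q)) ∎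
    where
    |elemsX| = ≡.trans (≡.sym (Listₚ.length-map toℕ (elems X))) |X|
    |elemsY| = ≡.trans (≡.sym (Listₚ.length-map toℕ (elems Y))) |Y|

  k₀≡suc-pred : ∀ {a b} → a < b → b < k → k₀ ≡ suc (pred k₀)
  k₀≡suc-pred a<b b<k with ℕₚ.≤-trans (ℕₚ.≤-trans (s≤s z≤n) a<b) (ℕₚ.≤-pred b<k)
  ... | s≤s _ = ≡.refl

  module IndexSet {p r : ℕ} (p≡ : suc p ≡ k +ℕ (k +ℕ r)) where

    open BlockIndices k₀ r using (size; Sℕ; Tℕ; Sℕ-S; Sℕ-T; filterᵇ-Sℕ; filterᵇ-Tℕ; module PairExchange; module QuadExchange)

    RS RT : Sub (suc p)
    RS = interval 0 k
    RT = interval k (2 *ℕ k)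

    toℕ-toFin-S : ∀ {a} → a < k → toℕ (toFin {p} a) ≡ a
    toℕ-toFin-S {a} a<k = toℕ-toFin (≡.subst (a <_) (≡.sym p≡) (ℕₚ.≤-trans a<k (ℕₚ.m≤m+n k (k +ℕ r))))

    toℕ-toFin-T : ∀ {a'} → a' < k → toℕ (toFin {p} (k +ℕ a')) ≡ k +ℕ a'
    toℕ-toFin-T {a'} a'<k = toℕ-toFin (≡.subst (k +ℕ a' <_) (≡.sym p≡) (ℕₚ.+-monoʳ-< k (ℕₚ.≤-trans a'<k (ℕₚ.m≤m+n k r))))

    elems-RS : map toℕ (elems RS) ≡ applyUpTo (λ x → x) k
    elems-RS = ≡.trans (map-toℕ-elems size RS Sℕ p≡ (λ _ → ≡.refl)) filterᵇ-Sℕ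

    elems-RT : map toℕ (elems RT) ≡ applyUpTo (k +ℕ_) k
    elems-RT = ≡.trans (map-toℕ-elems size RT Tℕ p≡ (λ _ → ≡.refl)) filterᵇ-Tℕ

    ΣS-RS : ∀ f → ΣS R RS f ≈ Σ k (λ a → f (toFin a))
    ΣS-RS f = sumL≈Σ (elems RS) f (λ x → x) k elems-RS

    ΣS-RT : ∀ f → ΣS R RT f ≈ Σ k (λ a' → f (toFin (k +ℕ a')))
    ΣS-RT f = sumL≈Σ (elems RT) f (k +ℕ_) k elems-RT

    rstar-S : ∀ {i : Fin (suc p)} {a} → toℕ i ≡ a → a < k → rstar RS RT i ≡ a
    rstar-S {i} i≡a a<k with RS i | ≡.trans (≡.cong Sℕ i≡a) (Sℕ-S a<k)
    ... | true  | _  = rank-from-elems RS i elems-RS i≡a (ℕₚ.<⇒≤ a<k)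
    ... | false | ()

    rstar-T : ∀ {i : Fin (suc p)} {a'} → toℕ i ≡ k +ℕ a' → a' < k → rstar RS RT i ≡ a'
    rstar-T {i} {a'} i≡ a'<k with RS i | ≡.trans (≡.cong Sℕ i≡) (Sℕ-T a')
    ... | false | _  = rank-from-elems RT i elems-RT i≡ (ℕₚ.<⇒≤ a'<k)
    ... | true  | ()

    sumℕ-∅ : ∀ (f : Fin (suc p) → ℕ) → sumℕ ∅ f ≡ 0
    sumℕ-∅ f = ≡.cong (foldr (λ i acc → f i +ℕ acc) 0) (filterᵇ-const-false (allFin (suc p)))

    module Pair {a a' : ℕ} (a<k : a < k) (a'<k : a' < k) where

      open PairExchange a<k a'<k

      i i' : Fin (suc p)
      i  = toFin a
      i' = toFin (k +ℕ a')

      i≡ = toℕ-toFin-S a<k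
      i'≡ = toℕ-toFin-T a'<k

      elems-RSΔpair : map toℕ (elems (RS Δ pair i i')) ≡ applyUpTo (punchIn a) k₀ ++ (k +ℕ a') ∷ []
      elems-RSΔpair = ≡.trans (map-toℕ-elems size (RS Δ pair i i') (Sℕ Δℕ pairℕ (toℕ i) (toℕ i')) p≡ (λ _ → ≡.refl))
        (≡.trans (≡.cong₂ (λ x y → filterᵇ (Sℕ Δℕ pairℕ x y) (upTo size)) i≡ i'≡) filterᵇ-SℕΔPℕ)

      elems-RTΔpair : map toℕ (elems (RT Δ pair i i')) ≡ a ∷ applyUpTo (λ x → k +ℕ punchIn a' x) k₀
      elems-RTΔpair = ≡.trans (map-toℕ-elems size (RT Δ pair i i') (Tℕ Δℕ pairℕ (toℕ i) (toℕ i')) p≡ (λ _ → ≡.refl))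
        (≡.trans (≡.cong₂ (λ x y → filterᵇ (Tℕ Δℕ pairℕ x y) (upTo size)) i≡ i'≡) filterᵇ-TℕΔPℕ)

      elems-pair : elems (pair i i') ≡ i ∷ i' ∷ []
      elems-pair = Listₚ.map-injective Finₚ.toℕ-injective
        (≡.trans (map-toℕ-elems size (pair i i') (pairℕ (toℕ i) (toℕ i')) p≡ (λ _ → ≡.refl))
          (≡.trans (≡.cong₂ (λ x y → filterᵇ (pairℕ x y) (upTo size)) i≡ i'≡)
            (≡.trans filterᵇ-Pℕ (≡.sym (≡.cong₂ (λ x y → x ∷ y ∷ []) i≡ i'≡)))))

      sumℕ-pair : sumℕ (pair i i') (rstar RS RT) ≡ a +ℕ (a' +ℕ 0)
      sumℕ-pair = ≡.trans (≡.cong (foldr (λ j acc → rstar RS RT j +ℕ acc) 0) elems-pair)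
        (≡.cong₂ (λ x y → x +ℕ (y +ℕ 0)) (rstar-S i≡ a<k) (rstar-T i'≡ a'<k))

    module Quad {a b a' b' : ℕ} (a<b : a < b) (b<k : b < k) (a'<b' : a' < b') (b'<k : b' < k) where

      k₁ : ℕ
      k₁ = pred k₀

      open QuadExchange {k₁ = k₁} (k₀≡suc-pred a<b b<k) a<b b<k a'<b' b'<k

      i h i' h' : Fin (suc p)
      i  = toFin a
      h  = toFin b
      i' = toFin (k +ℕ a')
      h' = toFin (k +ℕ b')

      i≡ = toℕ-toFin-S a<k
      h≡ = toℕ-toFin-S b<k
      i'≡ = toℕ-toFin-T a'<k
      h'≡ = toℕ-toFin-T b'<k

      elems-RSΔquad : map toℕ (elems (RS Δ quad i h i' h')) ≡ applyUpTo (λ x → punchIn b (punchIn a x)) k₁ ++ (k +ℕ a') ∷ (k +ℕ b') ∷ []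
      elems-RSΔquad = ≡.trans (map-toℕ-elems size (RS Δ quad i h i' h') (Sℕ Δℕ quadℕ (toℕ i) (toℕ h) (toℕ i') (toℕ h')) p≡ (λ _ → ≡.refl))
        (≡.trans (cong₄ (λ x y z w → filterᵇ (Sℕ Δℕ quadℕ x y z w) (upTo size)) i≡ h≡ i'≡ h'≡) filterᵇ-SℕΔQℕ)

      elems-RTΔquad : map toℕ (elems (RT Δ quad i h i' h')) ≡ a ∷ b ∷ applyUpTo (λ x → k +ℕ punchIn b' (punchIn a' x)) k₁
      elems-RTΔquad = ≡.trans (map-toℕ-elems size (RT Δ quad i h i' h') (Tℕ Δℕ quadℕ (toℕ i) (toℕ h) (toℕ i') (toℕ h')) p≡ (λ _ → ≡.refl))
        (≡.trans (cong₄ (λ x y z w → filterᵇ (Tℕ Δℕ quadℕ x y z w) (upTo size)) i≡ h≡ i'≡ h'≡) filterᵇ-TℕΔQℕ)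

      elems-quad : elems (quad i h i' h') ≡ i ∷ h ∷ i' ∷ h' ∷ []
      elems-quad = Listₚ.map-injective Finₚ.toℕ-injective
        (≡.trans (map-toℕ-elems size (quad i h i' h') (quadℕ (toℕ i) (toℕ h) (toℕ i') (toℕ h')) p≡ (λ _ → ≡.refl))
          (≡.trans (cong₄ (λ x y z w → filterᵇ (quadℕ x y z w) (upTo size)) i≡ h≡ i'≡ h'≡)
            (≡.trans filterᵇ-Qℕ (≡.sym (cong₄ (λ x y z w → x ∷ y ∷ z ∷ w ∷ []) i≡ h≡ i'≡ h'≡)))))

      sumℕ-quad : sumℕ (quad i h i' h') (rstar RS RT) ≡ a +ℕ (b +ℕ (a' +ℕ (b' +ℕ 0)))
      sumℕ-quad = ≡.trans (≡.cong (foldr (λ j acc → rstar RS RT j +ℕ acc) 0) elems-quad)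
        (cong₄ (λ x y z w → x +ℕ (y +ℕ (z +ℕ (w +ℕ 0)))) (rstar-S i≡ a<k) (rstar-S h≡ b<k) (rstar-T i'≡ a'<k) (rstar-T h'≡ b'<k))

  module Rows = IndexSet m≡
  module Cols = IndexSet n≡

  det-inS-cols : ∀ (C : Matrix) → det k (λ p q → C p (nth (applyUpTo (λ x → x) k) q)) ≈ det k (λ p q → C p (inS q))
  det-inS-cols C = det-cong k (λ p q _ q<k → reflexive (≡.cong (C p) (nth-applyUpTo (λ x → x) k q<k)))

  det-inT-cols : ∀ (C : Matrix) → det k (λ p q → C p (nth (applyUpTo (k +ℕ_) k) q)) ≈ det k (λ p q → C p (inT q))
  det-inT-cols C = det-cong k (λ p q _ q<k → reflexive (≡.cong (C p) (nth-applyUpTo (k +ℕ_) k q<k)))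

  minors≈D₀ : minor R A Rows.RS Cols.RS * minor R A Rows.RT Cols.RT ≈ D₀
  minors≈D₀ = *-cong
    (trans (minor≈det Rows.RS Cols.RS Rows.elems-RS Cols.elems-RS (Listₚ.length-applyUpTo (λ x → x) k) (Listₚ.length-applyUpTo (λ x → x) k))
      (det-cong k (λ p q p<k q<k → reflexive (≡.cong₂ B (nth-applyUpTo (λ x → x) k p<k) (nth-applyUpTo (λ x → x) k q<k)))))
    (trans (minor≈det Rows.RT Cols.RT Rows.elems-RT Cols.elems-RT (Listₚ.length-applyUpTo (k +ℕ_) k) (Listₚ.length-applyUpTo (k +ℕ_) k))
      (det-cong k (λ p q p<k q<k → reflexive (≡.cong₂ B (nth-applyUpTo (k +ℕ_) k p<k) (nth-applyUpTo (k +ℕ_) k q<k)))))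

  module Summand₁ {a a' c c' : ℕ} (a<k : a < k) (a'<k : a' < k) (c<k : c < k) (c'<k : c' < k) where

    open Rows.Pair a<k a'<k using (i; i'; elems-RSΔpair; elems-RTΔpair; sumℕ-pair)
    open Cols.Pair c<k c'<k using () renaming (i to j; i' to j'; elems-RSΔpair to elems-CSΔpair; elems-RTΔpair to elems-CTΔpair; sumℕ-pair to sumℕ-colPair)

    minorS : minor R A (Rows.RS Δ pair i i') (Cols.RS Δ pair j j') ≈ sign (k₀ +ℕ a) * (sign (k₀ +ℕ c) * det k (block (exchS a a') (exchS c c')))
    minorS = begin
      minor R A (Rows.RS Δ pair i i') (Cols.RS Δ pair j j')
        ≈⟨ minor≈det (Rows.RS Δ pair i i') (Cols.RS Δ pair j j') elems-RSΔpair elems-CSΔpair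
             (length-punched-last (punchIn a) k₀ (k +ℕ a')) (length-punched-last (punchIn c) k₀ (k +ℕ c')) ⟩
      det k (λ p q → B (nth rows p) (nth cols q))
        ≈⟨ det-lastRowToPlace k₀ (λ x q → B x (nth cols q)) a (k +ℕ a') (nth rows) (ℕₚ.≤-pred a<k)
             (λ _ → nth-applyUpTo-++ˡ (punchIn a) k₀ _) (nth-punched-last (punchIn a) k₀ (k +ℕ a')) ⟩
      sign (k₀ +ℕ a) * det k (λ p q → B (exchS a a' p) (nth cols q))
        ≈⟨ *-congˡ (det-cols-from-rows k (λ p y → B (exchS a a' p) y) (nth cols) (exchS c c') (sign (k₀ +ℕ c))
              (λ C → det-lastRowToPlace k₀ C c (k +ℕ c') (nth cols) (ℕₚ.≤-pred c<k)
                       (λ _ → nth-applyUpTo-++ˡ (punchIn c) k₀ _) (nth-punched-last (punchIn c) k₀ (k +ℕ c')))) ⟩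
      sign (k₀ +ℕ a) * (sign (k₀ +ℕ c) * det k (block (exchS a a') (exchS c c'))) ∎
      where
      rows = applyUpTo (punchIn a) k₀ ++ (k +ℕ a') ∷ []
      cols = applyUpTo (punchIn c) k₀ ++ (k +ℕ c') ∷ []

    minorT : minor R A (Rows.RT Δ pair i i') (Cols.RT Δ pair j j') ≈ sign a' * (sign c' * det k (block (exchT a' a) (exchT c' c)))
    minorT = begin
      minor R A (Rows.RT Δ pair i i') (Cols.RT Δ pair j j')
        ≈⟨ minor≈det (Rows.RT Δ pair i i') (Cols.RT Δ pair j j') elems-RTΔpair elems-CTΔpair
             (≡.cong suc (Listₚ.length-applyUpTo _ k₀)) (≡.cong suc (Listₚ.length-applyUpTo _ k₀)) ⟩
      det k (λ p q → B (nth rows p) (nth cols q))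
        ≈⟨ det-firstRowToPlace k₀ (λ x q → B x (nth cols q)) k a' a (nth rows) (ℕₚ.≤-pred a'<k) ≡.refl
             (λ _ → nth-applyUpTo (λ z → k +ℕ punchIn a' z) k₀) ⟩
      sign a' * det k (λ p q → B (exchT a' a p) (nth cols q))
        ≈⟨ *-congˡ (det-cols-from-rows k (λ p y → B (exchT a' a p) y) (nth cols) (exchT c' c) (sign c')
              (λ C → det-firstRowToPlace k₀ C k c' c (nth cols) (ℕₚ.≤-pred c'<k) ≡.refl (λ _ → nth-applyUpTo (λ z → k +ℕ punchIn c' z) k₀))) ⟩
      sign a' * (sign c' * det k (block (exchT a' a) (exchT c' c))) ∎
      where
      rows = a ∷ applyUpTo (λ x → k +ℕ punchIn a' x) k₀
      cols = c ∷ applyUpTo (λ x → k +ℕ punchIn c' x) k₀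

    value : δ R Rows.RS Rows.RT Cols.RS Cols.RT (pair i i') (pair j j')
              * (minor R A (Rows.RS Δ pair i i') (Cols.RS Δ pair j j') * minor R A (Rows.RT Δ pair i i') (Cols.RT Δ pair j j'))
            ≈ detPair (exchS a a') (exchT a' a) (exchS c c') (exchT c' c)
    value = trans (*-cong (reflexive (≡.cong sign (≡.cong₂ _+ℕ_ sumℕ-pair sumℕ-colPair))) (*-cong minorS minorT))
      (sign-even-cancel₄ ((a +ℕ (a' +ℕ 0)) +ℕ (c +ℕ (c' +ℕ 0))) (k₀ +ℕ a) (k₀ +ℕ c) a' c' (a +ℕ a' +ℕ c +ℕ c' +ℕ k₀) (solve-∀′ a a' c c' k₀))
      where
      solve-∀′ : ∀ a a' c c' k₀ → ((a +ℕ (a' +ℕ 0)) +ℕ (c +ℕ (c' +ℕ 0))) +ℕ ((k₀ +ℕ a) +ℕ ((k₀ +ℕ c) +ℕ (a' +ℕ c')))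
                                   ≡ (a +ℕ a' +ℕ c +ℕ c' +ℕ k₀) +ℕ (a +ℕ a' +ℕ c +ℕ c' +ℕ k₀)
      solve-∀′ = solve-∀

  module Summand₂ {a a' : ℕ} (a<k : a < k) (a'<k : a' < k) where

    open Rows.Pair a<k a'<k using (i; i'; elems-RSΔpair; elems-RTΔpair; sumℕ-pair)

    minorS : minor R A (Rows.RS Δ pair i i') Cols.RS ≈ sign (k₀ +ℕ a) * det k (block (exchS a a') inS)
    minorS = begin
      minor R A (Rows.RS Δ pair i i') Cols.RS
        ≈⟨ minor≈det (Rows.RS Δ pair i i') Cols.RS elems-RSΔpair Cols.elems-RS
             (length-punched-last (punchIn a) k₀ (k +ℕ a')) (Listₚ.length-applyUpTo (λ x → x) k) ⟩
      det k (λ p q → B (nth rows p) (nth (applyUpTo (λ x → x) k) q))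
        ≈⟨ det-lastRowToPlace k₀ (λ x q → B x (nth (applyUpTo (λ x → x) k) q)) a (k +ℕ a') (nth rows) (ℕₚ.≤-pred a<k)
             (λ _ → nth-applyUpTo-++ˡ (punchIn a) k₀ _) (nth-punched-last (punchIn a) k₀ (k +ℕ a')) ⟩
      sign (k₀ +ℕ a) * det k (λ p q → B (exchS a a' p) (nth (applyUpTo (λ x → x) k) q))
        ≈⟨ *-congˡ (det-inS-cols (λ p y → B (exchS a a' p) y)) ⟩
      sign (k₀ +ℕ a) * det k (block (exchS a a') inS) ∎
      where rows = applyUpTo (punchIn a) k₀ ++ (k +ℕ a') ∷ []

    minorT : minor R A (Rows.RT Δ pair i i') Cols.RT ≈ sign a' * det k (block (exchT a' a) inT)
    minorT = begin
      minor R A (Rows.RT Δ pair i i') Cols.RT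
        ≈⟨ minor≈det (Rows.RT Δ pair i i') Cols.RT elems-RTΔpair Cols.elems-RT
             (≡.cong suc (Listₚ.length-applyUpTo _ k₀)) (Listₚ.length-applyUpTo (k +ℕ_) k) ⟩
      det k (λ p q → B (nth rows p) (nth (applyUpTo (k +ℕ_) k) q))
        ≈⟨ det-firstRowToPlace k₀ (λ x q → B x (nth (applyUpTo (k +ℕ_) k) q)) k a' a (nth rows) (ℕₚ.≤-pred a'<k) ≡.refl
             (λ _ → nth-applyUpTo (λ z → k +ℕ punchIn a' z) k₀) ⟩
      sign a' * det k (λ p q → B (exchT a' a p) (nth (applyUpTo (k +ℕ_) k) q))
        ≈⟨ *-congˡ (det-inT-cols (λ p y → B (exchT a' a p) y)) ⟩
      sign a' * det k (block (exchT a' a) inT) ∎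
      where rows = a ∷ applyUpTo (λ x → k +ℕ punchIn a' x) k₀

    value : sign k * (δ R Rows.RS Rows.RT Cols.RS Cols.RT (pair i i') ∅
              * (minor R A (Rows.RS Δ pair i i') Cols.RS * minor R A (Rows.RT Δ pair i i') Cols.RT))
            ≈ - D₁ a a'
    value = trans (*-congˡ (*-cong (reflexive (≡.cong sign (≡.cong₂ _+ℕ_ sumℕ-pair (Cols.sumℕ-∅ (rstar Cols.RS Cols.RT))))) (*-cong minorS minorT)))
      (sign-odd-cancel₂ k ((a +ℕ (a' +ℕ 0)) +ℕ 0) (k₀ +ℕ a) a' (k₀ +ℕ a +ℕ a') (solve-∀′ a a' k₀))
      where
      solve-∀′ : ∀ a a' k₀ → suc k₀ +ℕ (((a +ℕ (a' +ℕ 0)) +ℕ 0) +ℕ ((k₀ +ℕ a) +ℕ a')) ≡ suc ((k₀ +ℕ a +ℕ a') +ℕ (k₀ +ℕ a +ℕ a'))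
      solve-∀′ = solve-∀

  module Summand₃ {a b a' b' : ℕ} (a<b : a < b) (b<k : b < k) (a'<b' : a' < b') (b'<k : b' < k) where

    open Rows.Quad a<b b<k a'<b' b'<k using (k₁; i; h; i'; h'; elems-RSΔquad; elems-RTΔquad; sumℕ-quad)

    k₀≡ : k₀ ≡ suc k₁
    k₀≡ = k₀≡suc-pred a<b b<k

    minorS : minor R A (Rows.RS Δ quad i h i' h') Cols.RS ≈ sign (suc (a +ℕ b)) * det k (block (exchS² a b a' b') inS)
    minorS = begin
      minor R A (Rows.RS Δ quad i h i' h') Cols.RS
        ≈⟨ minor≈det (Rows.RS Δ quad i h i' h') Cols.RS elems-RSΔquad Cols.elems-RS |rows| (Listₚ.length-applyUpTo (λ x → x) k) ⟩
      det k (λ p q → B (nth rows p) (nth (applyUpTo (λ x → x) k) q))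
        ≈⟨ det-lastTwoRowsToPlace k₀ k₁ (λ x q → B x (nth (applyUpTo (λ x → x) k) q)) (k +ℕ a') (k +ℕ b') (nth rows) k₀≡ a<b (ℕₚ.≤-pred b<k)
             (λ _ → nth-applyUpTo-++ˡ (λ z → punchIn b (punchIn a z)) k₁ _) rows-k₁ rows-k₀ ⟩
      sign (suc (a +ℕ b)) * det k (λ p q → B (exchS² a b a' b' p) (nth (applyUpTo (λ x → x) k) q))
        ≈⟨ *-congˡ (det-inS-cols (λ p y → B (exchS² a b a' b' p) y)) ⟩
      sign (suc (a +ℕ b)) * det k (block (exchS² a b a' b') inS) ∎
      where
      rows = applyUpTo (λ x → punchIn b (punchIn a x)) k₁ ++ (k +ℕ a') ∷ (k +ℕ b') ∷ []
      |rows| : length rows ≡ k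
      |rows| = ≡.trans (Listₚ.length-++ (applyUpTo (λ x → punchIn b (punchIn a x)) k₁))
        (≡.trans (≡.cong (_+ℕ 2) (Listₚ.length-applyUpTo _ k₁)) (≡.trans (ℕₚ.+-comm k₁ 2) (≡.cong suc (≡.sym k₀≡))))
      rows-k₁ : nth rows k₁ ≡ k +ℕ a'
      rows-k₁ = ≡.trans (≡.cong (nth rows) (≡.sym (ℕₚ.+-identityʳ k₁))) (nth-applyUpTo-++ʳ (λ x → punchIn b (punchIn a x)) k₁ _ 0)
      rows-k₀ : nth rows k₀ ≡ k +ℕ b'
      rows-k₀ = ≡.trans (≡.cong (nth rows) (≡.trans k₀≡ (ℕₚ.+-comm 1 k₁))) (nth-applyUpTo-++ʳ (λ x → punchIn b (punchIn a x)) k₁ _ 1)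

    minorT : minor R A (Rows.RT Δ quad i h i' h') Cols.RT ≈ sign (suc (a' +ℕ b')) * det k (block (exchT² a' b' a b) inT)
    minorT = begin
      minor R A (Rows.RT Δ quad i h i' h') Cols.RT
        ≈⟨ minor≈det (Rows.RT Δ quad i h i' h') Cols.RT elems-RTΔquad Cols.elems-RT
             (≡.cong suc (≡.trans (≡.cong suc (Listₚ.length-applyUpTo _ k₁)) (≡.sym k₀≡))) (Listₚ.length-applyUpTo (k +ℕ_) k) ⟩
      det k (λ p q → B (nth rows p) (nth (applyUpTo (k +ℕ_) k) q))
        ≈⟨ det-firstTwoRowsToPlace k₀ (λ x q → B x (nth (applyUpTo (k +ℕ_) k) q)) k a b (nth rows) a'<b' (ℕₚ.≤-pred b'<k) ≡.refl ≡.refl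
             (λ x 2+x<k → nth-applyUpTo (λ z → k +ℕ punchIn b' (punchIn a' z)) k₁
                            (ℕₚ.≤-pred (ℕₚ.≤-pred (ℕₚ.≤-trans 2+x<k (ℕₚ.≤-reflexive (≡.cong suc k₀≡)))))) ⟩
      sign (suc (a' +ℕ b')) * det k (λ p q → B (exchT² a' b' a b p) (nth (applyUpTo (k +ℕ_) k) q))
        ≈⟨ *-congˡ (det-inT-cols (λ p y → B (exchT² a' b' a b p) y)) ⟩
      sign (suc (a' +ℕ b')) * det k (block (exchT² a' b' a b) inT) ∎
      where rows = a ∷ b ∷ applyUpTo (λ x → k +ℕ punchIn b' (punchIn a' x)) k₁

    value : δ R Rows.RS Rows.RT Cols.RS Cols.RT (quad i h i' h') ∅
              * (minor R A (Rows.RS Δ quad i h i' h') Cols.RS * minor R A (Rows.RT Δ quad i h i' h') Cols.RT)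
            ≈ D₂ a b a' b'
    value = trans (*-cong (reflexive (≡.cong sign (≡.cong₂ _+ℕ_ sumℕ-quad (Cols.sumℕ-∅ (rstar Cols.RS Cols.RT))))) (*-cong minorS minorT))
      (sign-even-cancel₂ ((a +ℕ (b +ℕ (a' +ℕ (b' +ℕ 0)))) +ℕ 0) (suc (a +ℕ b)) (suc (a' +ℕ b')) (suc (a +ℕ b +ℕ a' +ℕ b')) (solve-∀′ a b a' b'))
      where
      solve-∀′ : ∀ a b a' b' → ((a +ℕ (b +ℕ (a' +ℕ (b' +ℕ 0)))) +ℕ 0) +ℕ (suc (a +ℕ b) +ℕ suc (a' +ℕ b'))
                                ≡ suc (a +ℕ b +ℕ a' +ℕ b') +ℕ suc (a +ℕ b +ℕ a' +ℕ b')
      solve-∀′ = solve-∀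

  s₁≈t₁ : ΣS R Rows.RS (λ i → ΣS R Rows.RT (λ i' → ΣS R Cols.RS (λ j → ΣS R Cols.RT (λ j' →
            δ R Rows.RS Rows.RT Cols.RS Cols.RT (pair i i') (pair j j')
              * (minor R A (Rows.RS Δ pair i i') (Cols.RS Δ pair j j') * minor R A (Rows.RT Δ pair i i') (Cols.RT Δ pair j j'))))))
          ≈ t₁
  s₁≈t₁ = trans (Rows.ΣS-RS _) (Σ-cong k (λ a a<k → trans (Rows.ΣS-RT _) (Σ-cong k (λ a' a'<k →
            trans (Cols.ΣS-RS _) (Σ-cong k (λ c c<k → trans (Cols.ΣS-RT _) (Σ-cong k (λ c' c'<k →
              Summand₁.value a<k a'<k c<k c'<k))))))))

  s₂≈-t₂ : sign k * ΣS R Rows.RS (λ i → ΣS R Rows.RT (λ i' →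
             δ R Rows.RS Rows.RT Cols.RS Cols.RT (pair i i') ∅ * (minor R A (Rows.RS Δ pair i i') Cols.RS * minor R A (Rows.RT Δ pair i i') Cols.RT)))
           ≈ - t₂
  s₂≈-t₂ = begin
    sign k * ΣS R Rows.RS (λ i → ΣS R Rows.RT (summand i))
      ≈⟨ *-congˡ (trans (Rows.ΣS-RS _) (Σ-cong′ k (λ a → Rows.ΣS-RT _))) ⟩
    sign k * Σ k (λ a → Σ k (λ a' → summand (toFin a) (toFin (k +ℕ a'))))
      ≈⟨ trans (Σ-*ˡ k (sign k) _) (Σ-cong′ k (λ a → Σ-*ˡ k (sign k) _)) ⟩
    Σ k (λ a → Σ k (λ a' → sign k * summand (toFin a) (toFin (k +ℕ a'))))
      ≈⟨ Σ-cong k (λ a a<k → Σ-cong k (λ a' a'<k → Summand₂.value a<k a'<k)) ⟩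
    Σ k (λ a → Σ k (λ a' → - D₁ a a'))
      ≈⟨ trans (Σ-cong′ k (λ a → sym (Σ-neg k (D₁ a)))) (sym (Σ-neg k _)) ⟩
    - t₂ ∎
    where
    summand : Fin (suc m') → Fin (suc m') → Carrier
    summand i i' = δ R Rows.RS Rows.RT Cols.RS Cols.RT (pair i i') ∅ * (minor R A (Rows.RS Δ pair i i') Cols.RS * minor R A (Rows.RT Δ pair i i') Cols.RT)

  s₃≈t₃ : ΣS R Rows.RS (λ i → ΣS R Rows.RS (λ h → ΣS R Rows.RT (λ i' → ΣS R Rows.RT (λ h' →
            if toℕ i <ᵇ toℕ h then (if toℕ i' <ᵇ toℕ h' then
              δ R Rows.RS Rows.RT Cols.RS Cols.RT (quad i h i' h') ∅
                * (minor R A (Rows.RS Δ quad i h i' h') Cols.RS * minor R A (Rows.RT Δ quad i h i' h') Cols.RT)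
            else 0#) else 0#))))
          ≈ t₃
  s₃≈t₃ = trans (Rows.ΣS-RS _) (Σ-cong k (λ a a<k → trans (Rows.ΣS-RS _) (Σ-cong k (λ b b<k →
            trans (Rows.ΣS-RT _) (Σ-cong k (λ a' a'<k → trans (Rows.ΣS-RT _) (Σ-cong k (λ b' b'<k →
              if²-cong (≡.cong₂ _<ᵇ_ (Rows.toℕ-toFin-S a<k) (Rows.toℕ-toFin-S b<k))
                       (≡.trans (≡.cong₂ _<ᵇ_ (Rows.toℕ-toFin-T a'<k) (Rows.toℕ-toFin-T b'<k)) (<ᵇ-+ˡ k a' b'))
                       (λ a<ᵇb a'<ᵇb' → Summand₃.value (<ᵇ-true⇒< a b a<ᵇb) b<k (<ᵇ-true⇒< a' b' a'<ᵇb') b'<k)))))))))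

  lemma5p1-from : ∀ {S₁ S₂ S₃ S₀} → S₁ ≈ t₁ → S₂ ≈ - t₂ → S₃ ≈ t₃ → S₀ ≈ D₀ →
    S₁ - fromℕ (2 *ℕ k₀) * S₂ - fromℕ 4 * S₃ - fromℕ (k *ℕ k) * S₀ ≈ 0#
  lemma5p1-from e₁ e₂ e₃ e₀ = trans (+-cong (+-cong (+-cong e₁ (-‿cong (*-congˡ e₂))) (-‿cong (*-congˡ e₃))) (-‿cong (*-congˡ e₀))) blockIdentity


blocks+rest : ∀ {k m} → 2 *ℕ k ≤ m → m ≡ k +ℕ (k +ℕ (m ∸ 2 *ℕ k))
blocks+rest {k} {m} 2k≤m = ≡.trans (≡.sym (ℕₚ.m+[n∸m]≡n 2k≤m)) (2k+r≡k+[k+r] k (m ∸ 2 *ℕ k))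
  where
  2k+r≡k+[k+r] : ∀ k r → 2 *ℕ k +ℕ r ≡ k +ℕ (k +ℕ r)
  2k+r≡k+[k+r] = solve-∀

lemma5p1 : ∀ {c ℓ : Level} (R : CommutativeRing c ℓ) (k m n : ℕ) → 1 ≤ k → 2 *ℕ k ≤ m → 2 *ℕ k ≤ n
    → (A : Fin m → Fin n → CommutativeRing.Carrier R)
    → let open CommutativeRing R
          RS : Sub m
          RS = interval 0 k
          RT : Sub m
          RT = interval k (2 *ℕ k)
          CS : Sub n
          CS = interval 0 k
          CT : Sub n
          CT = interval k (2 *ℕ k)
          s1 = ΣS R RS (λ i → ΣS R RT (λ i' → ΣS R CS (λ j → ΣS R CT (λ j' →
                 δ R RS RT CS CT (pair i i') (pair j j')
                   * (minor R A (RS Δ pair i i') (CS Δ pair j j')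
                   * minor R A (RT Δ pair i i') (CT Δ pair j j'))))))
          s2 = sgn R k * ΣS R RS (λ i → ΣS R RT (λ i' →
                 δ R RS RT CS CT (pair i i') ∅
                   * (minor R A (RS Δ pair i i') CS * minor R A (RT Δ pair i i') CT)))
          s3 = ΣS R RS (λ i → ΣS R RS (λ h → ΣS R RT (λ i' → ΣS R RT (λ h' →
                 if toℕ i <ᵇ toℕ h then (if toℕ i' <ᵇ toℕ h' then
                   δ R RS RT CS CT (quad i h i' h') ∅
                     * (minor R A (RS Δ quad i h i' h') CS * minor R A (RT Δ quad i h i' h') CT)
                 else 0#) else 0#))))
      in s1 - nat R (2 *ℕ (k ∸ 1)) * s2 - nat R 4 * s3 - nat R (k *ℕ k) * (minor R A RS CS * minor R A RT CT) ≈ 0#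
lemma5p1 R (suc k₀) zero     n        _ () _   A
lemma5p1 R (suc k₀) (suc m') zero     _ _  ()  A
lemma5p1 R (suc k₀) (suc m') (suc n') _ 2k≤m 2k≤n A = lemma5p1-from s₁≈t₁ s₂≈-t₂ s₃≈t₃ minors≈D₀
  where open Minors R k₀ (blocks+rest {suc k₀} 2k≤m) (blocks+rest {suc k₀} 2k≤n) A
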